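{- Let $G=(V,E)$ be a finite undirected graph with $n=|V|\ge 1$. Let $\mathcal{B}$ be the chain $\emptyset=B_0\subsetneq\cdots\subsetneq B_k=V$ of all locally dense subsets of $V$, and let $\mathcal{C}$ be the chain of subsets produced by $\mathrm{GreedyLD}(G)$. Then for every $1\le i\le n$, $$p(i;\mathcal{C})\ge p(i;\mathcal{B})/2.$$
   Context: For $X\subseteq V$, $E(X)=\{(x,y)\in E: x,y\in X\}$. For disjoint $X,Y$, $E(X,Y)$ is the set of edges with one endpoint in $X$ and one in $Y$, $E_m(X,Y)=E(X)\cup E(X,Y)$, and for nonempty $X$ disjoint from $Y$, $d(X,Y)=|E_m(X,Y)|/|X|$; in general $d(X,Y)=d(X\setminus Y,Y)$. A set $W\subseteq V$ is locally dense if there do not exist a nonempty $X\subseteq W$ and a nonempty $Y\subseteq V$ with $Y\cap W=\emptyset$ such that $d(X,W\setminus X)\le d(Y,W)$; the locally dense sets form a chain from $\emptyset$ to $V$. Algorithm $\mathrm{GreedyLD}(G)$: for $i=n,n-1,\dots,1$, let $w_i$ be a vertex of minimum degree in the current graph and delete it (so $w_n$ is deleted first). Then set $j_0=0$ and, as long as $j_t<n$, let $j_{t+1}$ be an index $i>j_t$ maximizing $d(\{w_1,\dots,w_i\},\{w_1,\dots,w_{j_t}\})$. The output is the chain $\mathcal{C}$ consisting of the sets $C_t=\{w_1,\dots,w_{j_t}\}$, $t=0,1,\dots$ (so $C_0=\emptyset$ and the last set is $V$). Profile: for a nested chain $\mathcal{A}=(\emptyset=A_0\subsetneq A_1\subsetneq\cdots\subsetneq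 A_\ell=V)$ and integer $1\le i\le n$, let $j=\min\{x: |A_x|\ge i\}$ and define $p(i;\mathcal{A})=d(A_j,A_{j-1})$. -}

module Defs where

open import Data.Nat as ℕ using (ℕ; zero; suc; _<_; _≤_; _<ᵇ_; _≤ᵇ_)
open import Data.Bool using (Bool; true; false; _∧_; _∨_; if_then_else_; T)
open import Data.Fin using (Fin; toℕ)
open import Data.Fin.Subset using (Subset; ⊥; ⊤; _∪_; _─_; _∩_; ∁; _⊆_; _⊂_; ∣_∣; Nonempty)
open import Data.Vec using (Vec; tabulate; lookup)
open import Data.List using (List; []; _∷_; allFin; map)
open import Data.Bool.ListAction using (any)
open import Data.Nat.ListAction using (sum)
open import Data.List.Membership.Propositional using (_∈_)
open import Data.Integer using (+_)
open import Data.Rational.Unnormalised using (ℚᵘ; mkℚᵘ; 0ℚᵘ) renaming (_≤_ to _≤ℚ_)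
open import Data.Product using (_×_; ∃; ∃₂; _,_)
open import Data.Sum using (_⊎_)
open import Relation.Binary.PropositionalEquality using (_≡_)
open import Relation.Nullary using (¬_; does)
open import Function.Definitions using (Bijective)
import Data.Fin as F

record Graph (n : ℕ) : Set where
  field
    adj   : Fin n → Fin n → Bool
    sym   : ∀ u v → adj u v ≡ adj v u
    irrefl : ∀ v → adj v v ≡ false
open Graph public

infix 8 _∈ᵇ_
_∈ᵇ_ : ∀ {n} → Fin n → Subset n → Bool
v ∈ᵇ X = lookup X v

count : ∀ {n} → (Fin n → Bool) → ℕ
count {n} p = sum (map (λ v → if p v then 1 else 0) (allFin n))

-- |E_m(X,Y)| = |E(X) ∪ E(X,Y)|: number of edges {u,v} (counted once, via toℕ u < toℕ v)
-- with one endpoint in X and the other endpoint in X ∪ Y.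
edgesM : ∀ {n} → Graph n → Subset n → Subset n → ℕ
edgesM {n} G X Y =
  sum (map (λ u → count (λ v →
      (toℕ u <ᵇ toℕ v) ∧ adj G u v ∧
      ((u ∈ᵇ X ∧ v ∈ᵇ (X ∪ Y)) ∨ (v ∈ᵇ X ∧ u ∈ᵇ (X ∪ Y)))))
    (allFin n))

-- d(X,Y) = |E_m(X∖Y, Y)| / |X∖Y| ; (value 0 when X∖Y is empty, never used)
dens : ∀ {n} → Graph n → Subset n → Subset n → ℚᵘ
dens G X Y with ∣ X ─ Y ∣
... | zero  = 0ℚᵘ
... | suc k = mkℚᵘ (+ edgesM G (X ─ Y) Y) k

LocallyDense : ∀ {n} → Graph n → Subset n → Set
LocallyDense {n} G W =
  ¬ (∃₂ λ (X Y : Subset n) →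
       X ⊆ W × Nonempty X × Nonempty Y × (Y ∩ W ≡ ⊥) ×
       (dens G X (W ─ X) ≤ℚ dens G Y W))

-- A nested chain ∅ = A₀ ⊊ A₁ ⊊ ⋯ ⊊ A_ℓ = V, given by its first set 'prev'
-- and the list [A₁, …, A_ℓ].
StrictChain : ∀ {n} → Subset n → List (Subset n) → Set
StrictChain prev []       = prev ≡ ⊤
StrictChain prev (A ∷ As) = prev ⊂ A × StrictChain A As

-- Profile: p(i; A) = d(A_j, A_{j-1}) with j the least index with |A_j| ≥ i (j ≥ 1).
-- profileFrom prev As i scans As (preceded by prev) for the first set of size ≥ i.
profileFrom : ∀ {n} → Graph n → Subset n → List (Subset n) → ℕ → ℚᵘ
profileFrom G prev []       i = 0ℚᵘ
profileFrom G prev (A ∷ As) i =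
  if i ≤ᵇ ∣ A ∣ then dens G A prev else profileFrom G A As i

profile : ∀ {n} → Graph n → List (Subset n) → ℕ → ℚᵘ
profile G As i = profileFrom G ⊥ As i

-- GreedyLD.  The vertex order w₁,…,wₙ is encoded by w : Fin n → Fin n,
-- where w k is w_{toℕ k + 1}.
-- prefix w i = {w₁,…,w_i}
prefix : ∀ {n} → (Fin n → Fin n) → ℕ → Subset n
prefix {n} w i = tabulate (λ v → any (λ k → (toℕ k <ᵇ i) ∧ does (w k F.≟ v)) (allFin n))

degIn : ∀ {n} → Graph n → Subset n → Fin n → ℕ
degIn G S v = count (λ u → u ∈ᵇ S ∧ adj G v u)

-- The order is a valid peeling order: w_i (deleted when the current graph is the
-- graph induced on {w₁,…,w_i}) has minimum degree in that current graph.
GreedyOrder : ∀ {n} → Graph n → (Fin n → Fin n) → Set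
GreedyOrder {n} G w =
  Bijective _≡_ _≡_ w ×
  (∀ (k : Fin n) (u : Fin n) →
     let S = prefix w (suc (toℕ k)) in
     T (u ∈ᵇ S) → degIn G S (w k) ≤ degIn G S u)

-- The index sequence j₁, j₂, …, j_m (with j₀ = 0 given as 'prev') of the second phase:
-- each j_{t+1} > j_t is an index maximizing d({w₁..w_i},{w₁..w_{j_t}}) over i > j_t,
-- and the process stops exactly when j_t = n.
GreedyIndices : ∀ {n} → Graph n → (Fin n → Fin n) → ℕ → List ℕ → Set
GreedyIndices {n} G w prev []       = prev ≡ n
GreedyIndices {n} G w prev (j ∷ js) =
  prev < n × prev < j × j ≤ n ×
  (∀ i → prev < i → i ≤ n →
     dens G (prefix w i) (prefix w prev) ≤ℚ dens G (prefix w j) (prefix w prev)) ×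
  GreedyIndices G w j js

greedyChain : ∀ {n} → (Fin n → Fin n) → List ℕ → List (Subset n)
greedyChain w js = map (prefix w) js

module Submission where

-- Let W ⊊ B be the consecutive locally dense sets with |W| < i ≤ |B|, so that p(i; B) = d(B, W),
-- and put D = B ∖ W.  Among the nonempty sets outside W that maximise d(·, W), a largest one M
-- makes M ∪ W locally dense (this is where supermodularity of the edge count enters), so B ⊆ M ∪ W,
-- and local density of B then shows that D itself maximises d(·, W).  Hence every vertex of B has
-- degree at least d(B, W) inside B: for a vertex of W by local density of W, for a vertex x of D
-- because d(D ∖ {x}, W) ≤ d(D, W).  Let x be the vertex of B removed first by the greedy peeling
-- and P the graph remaining at that moment.  Then B ⊆ P and every vertex of P has degree at least
-- deg_P(x) ≥ d(B, W) in P, so summing degrees over P ∖ P_a (which counts each edge at most twice)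
-- gives d(P, P_a) ≥ d(B, W) / 2, while the greedy choice of j gives p(i; C) = d(P_j, P_a) ≥ d(P, P_a).

open import Data.Bool using (Bool; true; false; _∧_; _∨_; if_then_else_; T) renaming (_≟_ to _≟ᵇ_)
open import Data.Bool.ListAction using (any)
open import Data.Bool.Properties using (T-≡; T-∧; ∧-comm; ∧-zeroʳ; ∨-comm)
open import Data.Empty using (⊥-elim)
open import Data.Fin as F using (Fin; zero; suc; toℕ)
open import Data.Fin.Permutation using (permutation)
open import Data.Fin.Properties using (toℕ-injective; toℕ<n)
open import Data.Fin.Subset using (Subset; ⊥; _∪_; _∩_; _─_; ⁅_⁆; ∣_∣; _⊆_; Nonempty; inside; outside)
  renaming (_∈_ to _∈ₛ_)
open import Data.Fin.Subset.Properties
  using (_∈?_; nonempty?; Empty-unique; ∉⊥; x∈⁅y⁆⇒x≡y; x∈p∩q⁺; x∈p∩q⁻; x∈p∪q⁻; x∈p∧x∉q⇒x∈p─q;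
         drop-∷-⊆; ⊆-refl; ⊆-trans; p⊆p∪q; q⊆p∪q; p∩q⊆p; p─q⊆p; p⊆q⇒∣p∣≤∣q∣;
         ∣⊥∣≡0; ∣⊤∣≡n; ∣⁅x⁆∣≡1; ∪-assoc; ∪-comm; ∪-identityˡ; ∩-comm; ∩-distribˡ-∪; ∩-distribʳ-∪)
import Data.Integer as ℤ
import Data.Integer.Properties as ℤₚ
open import Data.List using (List; []; _∷_; _++_; map; allFin; filter; tabulate)
open import Data.List.Membership.Propositional using (_∈_; lose)
open import Data.List.Membership.Propositional.Properties using (∈-map⁺; ∈-++⁺ˡ; ∈-++⁺ʳ; ∈-filter⁺; ∈-allFin)
import Data.List.Relation.Unary.All as All
open import Data.List.Relation.Unary.All.Properties using (all-filter)
open import Data.List.Relation.Unary.Any using (here; there; satisfied)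
open import Data.List.Relation.Unary.Any.Properties using (any⁺; any⁻)
open import Data.List.Properties using (map-tabulate)
open import Data.Nat using (ℕ; zero; suc; _+_; _*_; _≤_; _<_; _<ᵇ_; _≤ᵇ_; _≤?_; z≤n; s≤s; >-nonZero)
import Data.Nat.ListAction as List
open import Data.Nat.Properties
open import Algebra.Properties.CommutativeMonoid.Sum +-0-commutativeMonoid
  using (sum; sum-syntax; sum-cong-≗; ∑-distrib-+; ∑-comm; sum-permute)
open import Algebra.Properties.Semiring.Sum +-*-semiring using (*-distribˡ-sum)
open import Data.Nat.Tactic.RingSolver using (solve-∀)
open import Data.Product using (_×_; _,_; ∃; proj₁; proj₂; map₂)
open import Data.Rational.Unnormalised using (mkℚᵘ; *≤*; ½) renaming (_≤_ to _≤ℚ_; _*_ to _*ℚ_)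
import Data.Rational.Unnormalised.Properties as ℚ
open import Data.Sum using (_⊎_; inj₁; inj₂; [_,_]′)
open import Data.Vec using (_∷_; []; here)
open import Data.Vec.Properties
  using (≡-dec; lookup∘tabulate; lookup-zipWith; lookup-replicate; []=⇒lookup; lookup⇒[]=; ∷-injectiveʳ)
open import Defs hiding (sym)
open import Function using (_∘_; _⇔_; mk⇔; Equivalence)
open import Function.Definitions using (Bijective)
open import Level using (0ℓ)
open import Relation.Binary using (TotalOrder)
open import Relation.Binary.PropositionalEquality
open import Relation.Nullary using (¬_; yes; no; does; contradiction)
open import Relation.Nullary.Decidable using (_×-dec_)
open import Relation.Nullary.Reflects using (ofʸ; ofⁿ)
open import Relation.Unary using (Pred; Decidable)

private variable
  n : ℕ

-- Fractions compared by cross-multiplication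

infix 4 _/_≼_/_ _/_≺_/_

_/_≼_/_ : ℕ → ℕ → ℕ → ℕ → Set
a / b ≼ c / d = a * d ≤ c * b

_/_≺_/_ : ℕ → ℕ → ℕ → ℕ → Set
a / b ≺ c / d = a * d < c * b

*-swapʳ : ∀ x y z → x * y * z ≡ x * z * y
*-swapʳ = solve-∀

≼-trans : ∀ {a b c d e f} → 0 < d → a / b ≼ c / d → c / d ≼ e / f → a / b ≼ e / f
≼-trans {a} {b} {c} {d} {e} {f} 0<d ad≤cb cf≤ed = *-cancelʳ-≤ (a * f) (e * b) d {{>-nonZero 0<d}} (begin
  a * f * d  ≡⟨ *-swapʳ a f d ⟩
  a * d * f  ≤⟨ *-monoˡ-≤ f ad≤cb ⟩
  c * b * f  ≡⟨ *-swapʳ c b f ⟩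
  c * f * b  ≤⟨ *-monoˡ-≤ b cf≤ed ⟩
  e * d * b  ≡⟨ *-swapʳ e d b ⟩
  e * b * d  ∎)
  where open ≤-Reasoning

≺-≼-trans : ∀ {a b c d e f} → 0 < f → a / b ≺ c / d → c / d ≼ e / f → a / b ≺ e / f
≺-≼-trans {a} {b} {c} {d} {e} {f} 0<f ad<cb cf≤ed = *-cancelʳ-< _ (a * f) (e * b) (begin-strict
  a * f * d  ≡⟨ *-swapʳ a f d ⟩
  a * d * f  <⟨ *-monoˡ-< f {{>-nonZero 0<f}} ad<cb ⟩
  c * b * f  ≡⟨ *-swapʳ c b f ⟩
  c * f * b  ≤⟨ *-monoˡ-≤ b cf≤ed ⟩
  e * d * b  ≡⟨ *-swapʳ e d b ⟩
  e * b * d  ∎)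
  where open ≤-Reasoning

mediant-≼ : ∀ {a b c d} → a / b ≼ c / d → (a + c) / (b + d) ≼ c / d
mediant-≼ {a} {b} {c} {d} ad≤cb = begin
  (a + c) * d    ≡⟨ *-distribʳ-+ d a c ⟩
  a * d + c * d  ≤⟨ +-monoˡ-≤ (c * d) ad≤cb ⟩
  c * b + c * d  ≡⟨ *-distribˡ-+ c b d ⟨
  c * (b + d)    ∎
  where open ≤-Reasoning

mediant-≺⁻ : ∀ {a b c d} → (a + c) / (b + d) ≺ c / d → a / b ≺ c / d
mediant-≺⁻ {a} {b} {c} {d} lt =
  +-cancelʳ-< (c * d) (a * d) (c * b) (subst₂ _<_ (*-distribʳ-+ d a c) (*-distribˡ-+ c b d) lt)

≼-mediant⇒mediant-≼ : ∀ {a b c d} → c / d ≼ (a + c) / (b + d) → (a + c) / (b + d) ≼ a / b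
≼-mediant⇒mediant-≼ {a} {b} {c} {d} le = begin
  (a + c) * b    ≡⟨ *-distribʳ-+ b a c ⟩
  a * b + c * b  ≤⟨ +-monoʳ-≤ (a * b) cb≤ad ⟩
  a * b + a * d  ≡⟨ *-distribˡ-+ a b d ⟨
  a * (b + d)    ∎
  where
  open ≤-Reasoning
  cb≤ad : c * b ≤ a * d
  cb≤ad = +-cancelʳ-≤ (c * d) (c * b) (a * d) (subst₂ _≤_ (*-distribˡ-+ c b d) (*-distribʳ-+ d a c) le)

-- With ρ = h / t:  m ≥ h + k − h′ ≥ ρ t + ρ s₁ − ρ t₁ = ρ s.
exchange : ∀ {h k m h′ s s₁ s₂ t t₁} → h + k ≤ m + h′ → h / t ≼ k / s₁ → h′ / t₁ ≼ h / t →
           t ≡ t₁ + s₂ → s ≡ s₂ + s₁ → h / t ≼ m / s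
exchange {h} {k} {m} {h′} {s} {s₁} {s₂} {t} {t₁} hk≤mh′ hs₁≤kt h′t≤ht₁ refl refl = begin
  h * (s₂ + s₁)      ≡⟨ *-distribˡ-+ h s₂ s₁ ⟩
  h * s₂ + h * s₁    ≤⟨ +-monoʳ-≤ (h * s₂) hs₁≤kt ⟩
  h * s₂ + k * t     ≤⟨ +-cancelˡ-≤ (h * t₁) (h * s₂ + k * t) (m * t) shifted ⟩
  m * t              ∎
  where
  open ≤-Reasoning
  shifted : h * t₁ + (h * s₂ + k * t) ≤ h * t₁ + m * t
  shifted = begin
    h * t₁ + (h * s₂ + k * t)  ≡⟨ +-assoc (h * t₁) (h * s₂) (k * t) ⟨
    h * t₁ + h * s₂ + k * t    ≡⟨ cong (_+ k * t) (*-distribˡ-+ h t₁ s₂) ⟨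
    h * t + k * t              ≡⟨ *-distribʳ-+ t h k ⟨
    (h + k) * t                ≤⟨ *-monoˡ-≤ t hk≤mh′ ⟩
    (m + h′) * t               ≡⟨ *-distribʳ-+ t m h′ ⟩
    m * t + h′ * t             ≤⟨ +-monoʳ-≤ (m * t) h′t≤ht₁ ⟩
    m * t + h * t₁             ≡⟨ +-comm (m * t) (h * t₁) ⟩
    h * t₁ + m * t             ∎

+-exchange : ∀ {a b e f g h k} → a + e ≡ b + f → f + e ≤ g + e + k → e ≡ h + k → a + h ≤ b + g
+-exchange {a} {b} {e} {f} {g} {h} {k} a+e≡b+f f+e≤g+e+k e≡h+k = +-cancelʳ-≤ (k + e) (a + h) (b + g) (begin
  a + h + (k + e)    ≡⟨ shuffle a h k e ⟩
  (a + e) + (h + k)  ≡⟨ cong₂ _+_ a+e≡b+f (sym e≡h+k) ⟩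
  b + f + e          ≡⟨ +-assoc b f e ⟩
  b + (f + e)        ≤⟨ +-monoʳ-≤ b f+e≤g+e+k ⟩
  b + (g + e + k)    ≡⟨ unshuffle b g e k ⟩
  b + g + (k + e)    ∎)
  where
  open ≤-Reasoning
  shuffle : ∀ a h k e → a + h + (k + e) ≡ (a + e) + (h + k)
  shuffle = solve-∀
  unshuffle : ∀ b g e k → b + (g + e + k) ≡ b + g + (k + e)
  unshuffle = solve-∀

double-≼⇔ : ∀ {a b s t} → (a + a) / s ≼ (b + b) / t ⇔ a / s ≼ b / t
double-≼⇔ {a} {b} {s} {t} = mk⇔
  (λ le → ≮⇒≥ (λ bs<at → <⇒≱ (+-mono-< bs<at bs<at) (subst₂ _≤_ (*-distribʳ-+ t a a) (*-distribʳ-+ s b b) le)))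
  (λ le → subst₂ _≤_ (sym (*-distribʳ-+ t a a)) (sym (*-distribʳ-+ s b b)) (+-mono-≤ le le))

mkℚᵘ-≤⇔ : ∀ {a k b l} → mkℚᵘ (ℤ.+ a) k ≤ℚ mkℚᵘ (ℤ.+ b) l ⇔ a / suc k ≼ b / suc l
mkℚᵘ-≤⇔ {a} {k} {b} {l} = mk⇔
  (λ { (*≤* le) → ℤₚ.drop‿+≤+ (subst₂ ℤ._≤_ (sym (ℤₚ.pos-* a (suc l))) (sym (ℤₚ.pos-* b (suc k))) le) })
  (λ le → *≤* (subst₂ ℤ._≤_ (ℤₚ.pos-* a (suc l)) (ℤₚ.pos-* b (suc k)) (ℤ.+≤+ le)))

mkℚᵘ-*½-≤ : ∀ {a k b l} → a / (suc k * 2) ≼ b / suc l → mkℚᵘ (ℤ.+ a) k *ℚ ½ ≤ℚ mkℚᵘ (ℤ.+ b) l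
mkℚᵘ-*½-≤ {a} {k} {b} {l} le = *≤* (subst₂ ℤ._≤_
  (trans (ℤₚ.pos-* a (suc l)) (cong (ℤ._* ℤ.+ suc l) (sym (ℤₚ.*-identityʳ (ℤ.+ a)))))
  (ℤₚ.pos-* b (suc k * 2)) (ℤ.+≤+ le))

-- Finite sums

⟦_⟧ : Bool → ℕ
⟦ b ⟧ = if b then 1 else 0

⟦∧⟧ : (b c : Bool) → ⟦ b ∧ c ⟧ ≡ ⟦ b ⟧ * ⟦ c ⟧
⟦∧⟧ true  c = sym (+-identityʳ ⟦ c ⟧)
⟦∧⟧ false c = refl

∑-zero : {f : Fin n → ℕ} → (∀ i → f i ≡ 0) → sum f ≡ 0
∑-zero {zero}  f≡0 = refl
∑-zero {suc n} f≡0 = cong₂ _+_ (f≡0 zero) (∑-zero (f≡0 ∘ suc))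

∑-mono-≤ : {f g : Fin n → ℕ} → (∀ i → f i ≤ g i) → sum f ≤ sum g
∑-mono-≤ {zero}  f≤g = z≤n
∑-mono-≤ {suc n} f≤g = +-mono-≤ (f≤g zero) (∑-mono-≤ (f≤g ∘ suc))

∑-allFin : (f : Fin n → ℕ) → List.sum (map f (allFin n)) ≡ sum f
∑-allFin {zero}  f = refl
∑-allFin {suc n} f = cong (f zero +_) (begin
  List.sum (map f (tabulate suc))          ≡⟨ cong List.sum (map-tabulate suc f) ⟩
  List.sum (tabulate (f ∘ suc))            ≡⟨ cong List.sum (map-tabulate (λ i → i) (f ∘ suc)) ⟨
  List.sum (map (f ∘ suc) (allFin n))      ≡⟨ ∑-allFin (f ∘ suc) ⟩
  sum (f ∘ suc)                            ∎)
  where open ≡-Reasoning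

count≡∑ : (p : Fin n → Bool) → count p ≡ ∑[ v < n ] ⟦ p v ⟧
count≡∑ p = ∑-allFin (λ v → ⟦ p v ⟧)

∑-<ᵇ : {i : ℕ} → i ≤ n → ∑[ k < n ] ⟦ toℕ k <ᵇ i ⟧ ≡ i
∑-<ᵇ {zero}  {zero}  _         = refl
∑-<ᵇ {suc n} {zero}  _         = ∑-zero {suc n} (λ _ → refl)
∑-<ᵇ {suc n} {suc i} (s≤s i≤n) = cong suc (∑-<ᵇ i≤n)

∑∑ : (Fin n → Fin n → ℕ) → ℕ
∑∑ {n} f = ∑[ u < n ] ∑[ v < n ] f u v

∑∑-cong : {f g : Fin n → Fin n → ℕ} → (∀ u v → f u v ≡ g u v) → ∑∑ f ≡ ∑∑ g
∑∑-cong f≡g = sum-cong-≗ (λ u → sum-cong-≗ (f≡g u))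

∑∑-mono-≤ : {f g : Fin n → Fin n → ℕ} → (∀ u v → f u v ≤ g u v) → ∑∑ f ≤ ∑∑ g
∑∑-mono-≤ f≤g = ∑-mono-≤ (λ u → ∑-mono-≤ (f≤g u))

∑∑-distrib-+ : (f g : Fin n → Fin n → ℕ) → ∑∑ (λ u v → f u v + g u v) ≡ ∑∑ f + ∑∑ g
∑∑-distrib-+ f g = trans (sum-cong-≗ (λ u → ∑-distrib-+ (f u) (g u)))
                         (∑-distrib-+ (λ u → sum (f u)) (λ u → sum (g u)))

∑∑-symmetrise : (R : Fin n → Fin n → Bool) → (∀ u v → R u v ≡ R v u) → (∀ u → R u u ≡ false) →
  let half = ∑∑ (λ u v → ⟦ (toℕ u <ᵇ toℕ v) ∧ R u v ⟧) in
  half + half ≡ ∑∑ (λ u v → ⟦ R u v ⟧)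
∑∑-symmetrise R R-sym R-irrefl = sym (trans (∑∑-cong split)
  (trans (∑∑-distrib-+ half (λ u v → half v u)) (cong (∑∑ half +_) (∑-comm (λ v u → half u v)))))
  where
  half : Fin _ → Fin _ → ℕ
  half u v = ⟦ (toℕ u <ᵇ toℕ v) ∧ R u v ⟧
  split : ∀ u v → ⟦ R u v ⟧ ≡ half u v + half v u
  split u v with toℕ u <ᵇ toℕ v | <ᵇ-reflects-< (toℕ u) (toℕ v)
               | toℕ v <ᵇ toℕ u | <ᵇ-reflects-< (toℕ v) (toℕ u)
  ... | true  | ofʸ u<v | true  | ofʸ v<u = ⊥-elim (<-asym u<v v<u)
  ... | true  | _       | false | _       = sym (+-identityʳ _)
  ... | false | _       | true  | _       = cong ⟦_⟧ (R-sym u v)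
  ... | false | ofⁿ u≮v | false | ofⁿ v≮u =
    cong ⟦_⟧ (trans (cong (R u) (toℕ-injective (≤-antisym (≮⇒≥ u≮v) (≮⇒≥ v≮u)))) (R-irrefl u))

-- Subsets

∈⇒∈ᵇ : {p : Subset n} {v : Fin n} → v ∈ₛ p → v ∈ᵇ p ≡ true
∈⇒∈ᵇ = []=⇒lookup

∈ᵇ⇒∈ : {p : Subset n} {v : Fin n} → v ∈ᵇ p ≡ true → v ∈ₛ p
∈ᵇ⇒∈ {p = p} {v} = lookup⇒[]= v p

∈ᵇ-∪ : (p q : Subset n) (v : Fin n) → v ∈ᵇ (p ∪ q) ≡ v ∈ᵇ p ∨ v ∈ᵇ q
∈ᵇ-∪ p q v = lookup-zipWith _∨_ v p q

∈ᵇ-∩ : (p q : Subset n) (v : Fin n) → v ∈ᵇ (p ∩ q) ≡ v ∈ᵇ p ∧ v ∈ᵇ q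
∈ᵇ-∩ p q v = lookup-zipWith _∧_ v p q

∈ᵇ-⁅⁆⇒≡ : {x v : Fin n} → v ∈ᵇ ⁅ x ⁆ ≡ true → v ≡ x
∈ᵇ-⁅⁆⇒≡ {x = x} = x∈⁅y⁆⇒x≡y x ∘ ∈ᵇ⇒∈

⊆⇒∈ᵇ : {p q : Subset n} → p ⊆ q → (v : Fin n) → v ∈ᵇ p ≡ true → v ∈ᵇ q ≡ true
⊆⇒∈ᵇ p⊆q v = ∈⇒∈ᵇ ∘ p⊆q ∘ ∈ᵇ⇒∈

∩≡⊥⇒∈ᵇ : {p q : Subset n} → p ∩ q ≡ ⊥ → (v : Fin n) → v ∈ᵇ p ∧ v ∈ᵇ q ≡ false
∩≡⊥⇒∈ᵇ {p = p} {q} p∩q≡⊥ v = trans (sym (∈ᵇ-∩ p q v)) (trans (cong (v ∈ᵇ_) p∩q≡⊥) (lookup-replicate v false))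

∩≡⊥⇒∉ : {p q : Subset n} {x : Fin n} → p ∩ q ≡ ⊥ → x ∈ₛ p → ¬ x ∈ₛ q
∩≡⊥⇒∉ {x = x} p∩q≡⊥ x∈p x∈q = ∉⊥ (subst (x ∈ₛ_) p∩q≡⊥ (x∈p∩q⁺ (x∈p , x∈q)))

∩≡⊥-mono : {p p′ q q′ : Subset n} → p′ ⊆ p → q′ ⊆ q → p ∩ q ≡ ⊥ → p′ ∩ q′ ≡ ⊥
∩≡⊥-mono {p′ = p′} {q′ = q′} p′⊆p q′⊆q p∩q≡⊥ = Empty-unique λ (x , x∈p′∩q′) →
  let (x∈p′ , x∈q′) = x∈p∩q⁻ p′ q′ x∈p′∩q′ in ∩≡⊥⇒∉ p∩q≡⊥ (p′⊆p x∈p′) (q′⊆q x∈q′)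

[p∪q]∩r≡⊥ : {p q r : Subset n} → p ∩ r ≡ ⊥ → q ∩ r ≡ ⊥ → (p ∪ q) ∩ r ≡ ⊥
[p∪q]∩r≡⊥ {p = p} {q} {r} p∩r≡⊥ q∩r≡⊥ =
  trans (∩-distribʳ-∪ r p q) (trans (cong₂ _∪_ p∩r≡⊥ q∩r≡⊥) (∪-identityˡ ⊥))

p∩[q∪r]≡⊥ : {p q r : Subset n} → p ∩ q ≡ ⊥ → p ∩ r ≡ ⊥ → p ∩ (q ∪ r) ≡ ⊥
p∩[q∪r]≡⊥ {p = p} {q} {r} p∩q≡⊥ p∩r≡⊥ =
  trans (∩-distribˡ-∪ p q r) (trans (cong₂ _∪_ p∩q≡⊥ p∩r≡⊥) (∪-identityˡ ⊥))

[p─q]∩q≡⊥ : (p q : Subset n) → (p ─ q) ∩ q ≡ ⊥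
[p─q]∩q≡⊥ []            []            = refl
[p─q]∩q≡⊥ (x       ∷ p) (inside  ∷ q) = cong (outside ∷_) ([p─q]∩q≡⊥ p q)
[p─q]∩q≡⊥ (inside  ∷ p) (outside ∷ q) = cong (outside ∷_) ([p─q]∩q≡⊥ p q)
[p─q]∩q≡⊥ (outside ∷ p) (outside ∷ q) = cong (outside ∷_) ([p─q]∩q≡⊥ p q)

p∩q≡⊥⇒p─q≡p : {p q : Subset n} → p ∩ q ≡ ⊥ → p ─ q ≡ p
p∩q≡⊥⇒p─q≡p {p = []}          {[]}          _     = refl
p∩q≡⊥⇒p─q≡p {p = inside  ∷ p} {inside  ∷ q} ()
p∩q≡⊥⇒p─q≡p {p = outside ∷ p} {inside  ∷ q} p∩q≡⊥ = cong (outside ∷_) (p∩q≡⊥⇒p─q≡p (∷-injectiveʳ p∩q≡⊥))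
p∩q≡⊥⇒p─q≡p {p = x       ∷ p} {outside ∷ q} p∩q≡⊥ = cong (x ∷_) (p∩q≡⊥⇒p─q≡p (∷-injectiveʳ p∩q≡⊥))

p⊆q⇒p∪q≡q : {p q : Subset n} → p ⊆ q → p ∪ q ≡ q
p⊆q⇒p∪q≡q {p = []}          {[]}          _   = refl
p⊆q⇒p∪q≡q {p = inside  ∷ p} {inside  ∷ q} p⊆q = cong (inside ∷_) (p⊆q⇒p∪q≡q (drop-∷-⊆ p⊆q))
p⊆q⇒p∪q≡q {p = inside  ∷ p} {outside ∷ q} p⊆q = contradiction (p⊆q here) λ ()
p⊆q⇒p∪q≡q {p = outside ∷ p} {y       ∷ q} p⊆q = cong (y ∷_) (p⊆q⇒p∪q≡q (drop-∷-⊆ p⊆q))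

p⊆q⇒p∩q≡p : {p q : Subset n} → p ⊆ q → p ∩ q ≡ p
p⊆q⇒p∩q≡p {p = []}          {[]}          _   = refl
p⊆q⇒p∩q≡p {p = inside  ∷ p} {inside  ∷ q} p⊆q = cong (inside ∷_) (p⊆q⇒p∩q≡p (drop-∷-⊆ p⊆q))
p⊆q⇒p∩q≡p {p = inside  ∷ p} {outside ∷ q} p⊆q = contradiction (p⊆q here) λ ()
p⊆q⇒p∩q≡p {p = outside ∷ p} {y       ∷ q} p⊆q = cong (outside ∷_) (p⊆q⇒p∩q≡p (drop-∷-⊆ p⊆q))

p⊆q⇒p∪[q─p]≡q : {p q : Subset n} → p ⊆ q → p ∪ (q ─ p) ≡ q
p⊆q⇒p∪[q─p]≡q {p = []}          {[]}          _   = refl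
p⊆q⇒p∪[q─p]≡q {p = inside  ∷ p} {inside  ∷ q} p⊆q = cong (inside ∷_) (p⊆q⇒p∪[q─p]≡q (drop-∷-⊆ p⊆q))
p⊆q⇒p∪[q─p]≡q {p = inside  ∷ p} {outside ∷ q} p⊆q = contradiction (p⊆q here) λ ()
p⊆q⇒p∪[q─p]≡q {p = outside ∷ p} {y       ∷ q} p⊆q = cong (y ∷_) (p⊆q⇒p∪[q─p]≡q (drop-∷-⊆ p⊆q))

q⊆p⇒p─[p─q]≡q : {p q : Subset n} → q ⊆ p → p ─ (p ─ q) ≡ q
q⊆p⇒p─[p─q]≡q {p = []}          {[]}          _   = refl
q⊆p⇒p─[p─q]≡q {p = inside  ∷ p} {inside  ∷ q} q⊆p = cong (inside ∷_) (q⊆p⇒p─[p─q]≡q (drop-∷-⊆ q⊆p))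
q⊆p⇒p─[p─q]≡q {p = outside ∷ p} {inside  ∷ q} q⊆p = contradiction (q⊆p here) λ ()
q⊆p⇒p─[p─q]≡q {p = inside  ∷ p} {outside ∷ q} q⊆p = cong (outside ∷_) (q⊆p⇒p─[p─q]≡q (drop-∷-⊆ q⊆p))
q⊆p⇒p─[p─q]≡q {p = outside ∷ p} {outside ∷ q} q⊆p = cong (outside ∷_) (q⊆p⇒p─[p─q]≡q (drop-∷-⊆ q⊆p))

[p∪q]─r≡[p─r]∪[q─r] : (p q r : Subset n) → (p ∪ q) ─ r ≡ (p ─ r) ∪ (q ─ r)
[p∪q]─r≡[p─r]∪[q─r] []      []      []            = refl
[p∪q]─r≡[p─r]∪[q─r] (x ∷ p) (y ∷ q) (inside  ∷ r) = cong (outside ∷_) ([p∪q]─r≡[p─r]∪[q─r] p q r)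
[p∪q]─r≡[p─r]∪[q─r] (x ∷ p) (y ∷ q) (outside ∷ r) = cong ((x ∨ y) ∷_) ([p∪q]─r≡[p─r]∪[q─r] p q r)

p─[p∩q]≡p─q : (p q : Subset n) → p ─ (p ∩ q) ≡ p ─ q
p─[p∩q]≡p─q []            []            = refl
p─[p∩q]≡p─q (inside  ∷ p) (inside  ∷ q) = cong (outside ∷_) (p─[p∩q]≡p─q p q)
p─[p∩q]≡p─q (inside  ∷ p) (outside ∷ q) = cong (inside ∷_) (p─[p∩q]≡p─q p q)
p─[p∩q]≡p─q (outside ∷ p) (inside  ∷ q) = cong (outside ∷_) (p─[p∩q]≡p─q p q)
p─[p∩q]≡p─q (outside ∷ p) (outside ∷ q) = cong (outside ∷_) (p─[p∩q]≡p─q p q)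

x∈p⇒⁅x⁆⊆p : {x : Fin n} {p : Subset n} → x ∈ₛ p → ⁅ x ⁆ ⊆ p
x∈p⇒⁅x⁆⊆p {x = x} {p} x∈p y∈⁅x⁆ = subst (_∈ₛ p) (sym (x∈⁅y⁆⇒x≡y x y∈⁅x⁆)) x∈p

∣∣≡∑ : (X : Subset n) → ∣ X ∣ ≡ ∑[ v < n ] ⟦ v ∈ᵇ X ⟧
∣∣≡∑ []            = refl
∣∣≡∑ (inside  ∷ X) = cong suc (∣∣≡∑ X)
∣∣≡∑ (outside ∷ X) = ∣∣≡∑ X

∣p∪q∣≡∣p∣+∣q∣ : {p q : Subset n} → p ∩ q ≡ ⊥ → ∣ p ∪ q ∣ ≡ ∣ p ∣ + ∣ q ∣
∣p∪q∣≡∣p∣+∣q∣ {p = []}          {[]}          _     = refl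
∣p∪q∣≡∣p∣+∣q∣ {p = inside  ∷ p} {inside  ∷ q} ()
∣p∪q∣≡∣p∣+∣q∣ {p = inside  ∷ p} {outside ∷ q} p∩q≡⊥ = cong suc (∣p∪q∣≡∣p∣+∣q∣ (∷-injectiveʳ p∩q≡⊥))
∣p∪q∣≡∣p∣+∣q∣ {p = outside ∷ p} {inside  ∷ q} p∩q≡⊥ =
  trans (cong suc (∣p∪q∣≡∣p∣+∣q∣ (∷-injectiveʳ p∩q≡⊥))) (sym (+-suc ∣ p ∣ ∣ q ∣))
∣p∪q∣≡∣p∣+∣q∣ {p = outside ∷ p} {outside ∷ q} p∩q≡⊥ = ∣p∪q∣≡∣p∣+∣q∣ (∷-injectiveʳ p∩q≡⊥)

∣p─q∣+∣p∩q∣≡∣p∣ : (p q : Subset n) → ∣ p ─ q ∣ + ∣ p ∩ q ∣ ≡ ∣ p ∣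
∣p─q∣+∣p∩q∣≡∣p∣ []            []            = refl
∣p─q∣+∣p∩q∣≡∣p∣ (inside  ∷ p) (inside  ∷ q) = trans (+-suc ∣ p ─ q ∣ ∣ p ∩ q ∣) (cong suc (∣p─q∣+∣p∩q∣≡∣p∣ p q))
∣p─q∣+∣p∩q∣≡∣p∣ (inside  ∷ p) (outside ∷ q) = cong suc (∣p─q∣+∣p∩q∣≡∣p∣ p q)
∣p─q∣+∣p∩q∣≡∣p∣ (outside ∷ p) (inside  ∷ q) = ∣p─q∣+∣p∩q∣≡∣p∣ p q
∣p─q∣+∣p∩q∣≡∣p∣ (outside ∷ p) (outside ∷ q) = ∣p─q∣+∣p∩q∣≡∣p∣ p q

Nonempty⇒0<∣∣ : {p : Subset n} → Nonempty p → 0 < ∣ p ∣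
Nonempty⇒0<∣∣ {p = p} (x , x∈p) = subst (_≤ ∣ p ∣) (∣⁅x⁆∣≡1 x) (p⊆q⇒∣p∣≤∣q∣ (x∈p⇒⁅x⁆⊆p x∈p))

0<∣∣⇒Nonempty : {p : Subset n} → 0 < ∣ p ∣ → Nonempty p
0<∣∣⇒Nonempty {n} {p} 0<∣p∣ with nonempty? p
... | yes p≢∅ = p≢∅
... | no  p≡∅ = contradiction (trans (cong ∣_∣ (Empty-unique p≡∅)) (∣⊥∣≡0 n)) (≢-sym (<⇒≢ 0<∣p∣))

q⊆p⇒Nonempty[p─q] : {p q : Subset n} → q ⊆ p → ∣ q ∣ < ∣ p ∣ → Nonempty (p ─ q)
q⊆p⇒Nonempty[p─q] {p = p} {q} q⊆p ∣q∣<∣p∣ =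
  0<∣∣⇒Nonempty (+-cancelʳ-< (∣ q ∣) 0 (∣ p ─ q ∣) (subst (∣ q ∣ <_) (sym ∣p─q∣+∣q∣≡∣p∣) ∣q∣<∣p∣))
  where
  ∣p─q∣+∣q∣≡∣p∣ : ∣ p ─ q ∣ + ∣ q ∣ ≡ ∣ p ∣
  ∣p─q∣+∣q∣≡∣p∣ = trans (cong (λ r → ∣ p ─ q ∣ + ∣ r ∣) (sym (trans (∩-comm p q) (p⊆q⇒p∩q≡p q⊆p))))
                        (∣p─q∣+∣p∩q∣≡∣p∣ p q)

∑-⊥ : (f : Fin n → ℕ) → ∑[ v < n ] (⟦ v ∈ᵇ ⊥ ⟧ * f v) ≡ 0
∑-⊥ f = ∑-zero (λ v → cong (λ b → ⟦ b ⟧ * f v) (lookup-replicate v false))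

∑-⁅⁆ : (x : Fin n) (f : Fin n → ℕ) → ∑[ v < n ] (⟦ v ∈ᵇ ⁅ x ⁆ ⟧ * f v) ≡ f x
∑-⁅⁆ zero    f = trans (cong₂ _+_ (+-identityʳ (f zero)) (∑-⊥ (f ∘ suc))) (+-identityʳ (f zero))
∑-⁅⁆ (suc x) f = ∑-⁅⁆ x (f ∘ suc)

*∣∣≤*∑ : {X : Subset n} {c k : ℕ} (f : Fin n → ℕ) → (∀ {u} → u ∈ₛ X → c ≤ k * f u) →
         c * ∣ X ∣ ≤ k * ∑[ u < n ] (⟦ u ∈ᵇ X ⟧ * f u)
*∣∣≤*∑ {n} {X} {c} {k} f c≤kf = begin
  c * ∣ X ∣                             ≡⟨ cong (c *_) (∣∣≡∑ X) ⟩
  c * ∑[ u < n ] ⟦ u ∈ᵇ X ⟧             ≡⟨ *-distribˡ-sum c (λ u → ⟦ u ∈ᵇ X ⟧) ⟩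
  ∑[ u < n ] (c * ⟦ u ∈ᵇ X ⟧)           ≤⟨ ∑-mono-≤ pointwise ⟩
  ∑[ u < n ] (k * (⟦ u ∈ᵇ X ⟧ * f u))   ≡⟨ *-distribˡ-sum k (λ u → ⟦ u ∈ᵇ X ⟧ * f u) ⟨
  k * ∑[ u < n ] (⟦ u ∈ᵇ X ⟧ * f u)     ∎
  where
  open ≤-Reasoning
  pointwise : ∀ u → c * ⟦ u ∈ᵇ X ⟧ ≤ k * (⟦ u ∈ᵇ X ⟧ * f u)
  pointwise u with u ∈ᵇ X in u∈X
  ... | false = subst (_≤ k * 0) (sym (*-zeroʳ c)) z≤n
  ... | true  = subst₂ (λ l r → l ≤ k * r) (sym (*-identityʳ c)) (sym (+-identityʳ (f u))) (c≤kf (∈ᵇ⇒∈ u∈X))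

subsets : (n : ℕ) → List (Subset n)
subsets zero    = [] ∷ []
subsets (suc n) = map (inside ∷_) (subsets n) ++ map (outside ∷_) (subsets n)

∈-subsets : (p : Subset n) → p ∈ subsets n
∈-subsets []            = here refl
∈-subsets (inside  ∷ p) = ∈-++⁺ˡ (∈-map⁺ (inside ∷_) (∈-subsets p))
∈-subsets (outside ∷ p) = ∈-++⁺ʳ _ (∈-map⁺ (outside ∷_) (∈-subsets p))

module _ {A : Set} (enum : List A) (complete : ∀ x → x ∈ enum) (O : TotalOrder 0ℓ 0ℓ 0ℓ) where
  open TotalOrder O using (Carrier) renaming (_≤_ to _⊑_)

  maximiser : {P : Pred A 0ℓ} → Decidable P → (f : A → Carrier) → ∃ P →
              ∃ λ m → P m × (∀ {x} → P x → f x ⊑ f m)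
  maximiser P? f (x₀ , Px₀) =
      argmax f x₀ (filter P? enum)
    , argmax-all f Px₀ (all-filter P? enum)
    , λ {x} Px → All.lookup (f[xs]≤f[argmax] x₀ (filter P? enum)) (∈-filter⁺ P? (complete x) Px)
    where open import Data.List.Extrema O

-- Edge counts and densities

module _ (G : Graph n) where

  -- Ordered pairs of adjacent vertices, so edges₂ S = 2 |E(S)| and edgesM₂ X Y = 2 |E_m(X, Y)|.
  adjIn : Subset n → Fin n → Fin n → Bool
  adjIn S u v = adj G u v ∧ u ∈ᵇ S ∧ v ∈ᵇ S

  adjM : Subset n → Subset n → Fin n → Fin n → Bool
  adjM X Y u v = adj G u v ∧ ((u ∈ᵇ X ∧ v ∈ᵇ (X ∪ Y)) ∨ (v ∈ᵇ X ∧ u ∈ᵇ (X ∪ Y)))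

  edges₂ : Subset n → ℕ
  edges₂ S = ∑∑ (λ u v → ⟦ adjIn S u v ⟧)

  edgesM₂ : Subset n → Subset n → ℕ
  edgesM₂ X Y = ∑∑ (λ u v → ⟦ adjM X Y u v ⟧)

  edgesM-double : (X Y : Subset n) → edgesM G X Y + edgesM G X Y ≡ edgesM₂ X Y
  edgesM-double X Y = begin
    edgesM G X Y + edgesM G X Y  ≡⟨ cong₂ _+_ unordered unordered ⟩
    ∑∑ half + ∑∑ half            ≡⟨ ∑∑-symmetrise (adjM X Y) adjM-sym adjM-irrefl ⟩
    edgesM₂ X Y                  ∎
    where
    open ≡-Reasoning
    half : Fin n → Fin n → ℕ
    half u v = ⟦ (toℕ u <ᵇ toℕ v) ∧ adjM X Y u v ⟧
    unordered : edgesM G X Y ≡ ∑∑ half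
    unordered = trans (∑-allFin (λ u → count (λ v → (toℕ u <ᵇ toℕ v) ∧ adjM X Y u v)))
                      (sum-cong-≗ (λ u → count≡∑ (λ v → (toℕ u <ᵇ toℕ v) ∧ adjM X Y u v)))
    adjM-sym : ∀ u v → adjM X Y u v ≡ adjM X Y v u
    adjM-sym u v = cong₂ _∧_ (Graph.sym G u v) (∨-comm (u ∈ᵇ X ∧ v ∈ᵇ (X ∪ Y)) (v ∈ᵇ X ∧ u ∈ᵇ (X ∪ Y)))
    adjM-irrefl : ∀ u → adjM X Y u u ≡ false
    adjM-irrefl u = cong (λ a → a ∧ ((u ∈ᵇ X ∧ u ∈ᵇ (X ∪ Y)) ∨ (u ∈ᵇ X ∧ u ∈ᵇ (X ∪ Y)))) (irrefl G u)

  degIn≡∑ : (S : Subset n) (x : Fin n) → degIn G S x ≡ ∑[ v < n ] ⟦ v ∈ᵇ S ∧ adj G x v ⟧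
  degIn≡∑ S x = count≡∑ (λ v → v ∈ᵇ S ∧ adj G x v)

  degIn-mono : {S S′ : Subset n} → S ⊆ S′ → (x : Fin n) → degIn G S x ≤ degIn G S′ x
  degIn-mono {S} {S′} S⊆S′ x = subst₂ _≤_ (sym (degIn≡∑ S x)) (sym (degIn≡∑ S′ x)) (∑-mono-≤ pointwise)
    where
    pointwise : ∀ v → ⟦ v ∈ᵇ S ∧ adj G x v ⟧ ≤ ⟦ v ∈ᵇ S′ ∧ adj G x v ⟧
    pointwise v with v ∈ᵇ S in v∈S
    ... | false = z≤n
    ... | true rewrite ⊆⇒∈ᵇ S⊆S′ v v∈S = ≤-refl

  edges₂-∪ : {X Y : Subset n} → X ∩ Y ≡ ⊥ → edges₂ (X ∪ Y) ≡ edgesM₂ X Y + edges₂ Y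
  edges₂-∪ {X} {Y} X∩Y≡⊥ =
    trans (∑∑-cong split) (∑∑-distrib-+ (λ u v → ⟦ adjM X Y u v ⟧) (λ u v → ⟦ adjIn Y u v ⟧))
    where
    split : ∀ u v → ⟦ adjIn (X ∪ Y) u v ⟧ ≡ ⟦ adjM X Y u v ⟧ + ⟦ adjIn Y u v ⟧
    split u v rewrite ∈ᵇ-∪ X Y u | ∈ᵇ-∪ X Y v =
      bool (adj G u v) (u ∈ᵇ X) (u ∈ᵇ Y) (v ∈ᵇ X) (v ∈ᵇ Y) (∩≡⊥⇒∈ᵇ X∩Y≡⊥ u) (∩≡⊥⇒∈ᵇ X∩Y≡⊥ v)
      where
      bool : ∀ a xu yu xv yv → xu ∧ yu ≡ false → xv ∧ yv ≡ false →
             ⟦ a ∧ (xu ∨ yu) ∧ (xv ∨ yv) ⟧ ≡ ⟦ a ∧ ((xu ∧ (xv ∨ yv)) ∨ (xv ∧ (xu ∨ yu))) ⟧ + ⟦ a ∧ yu ∧ yv ⟧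
      bool false _     _     _     _     _  _  = refl
      bool true  true  true  _     _     () _
      bool true  true  false true  _     _  _  = refl
      bool true  true  false false true  _  _  = refl
      bool true  true  false false false _  _  = refl
      bool true  false false true  _     _  _  = refl
      bool true  false false false _     _  _  = refl
      bool true  false true  true  true  _  ()
      bool true  false true  true  false _  _  = refl
      bool true  false true  false _     _  _  = refl

  edges₂-supermodular : (A B : Subset n) → edges₂ A + edges₂ B ≤ edges₂ (A ∪ B) + edges₂ (A ∩ B)
  edges₂-supermodular A B =
    subst₂ _≤_ (∑∑-distrib-+ (λ u v → ⟦ adjIn A u v ⟧) (λ u v → ⟦ adjIn B u v ⟧))
               (∑∑-distrib-+ (λ u v → ⟦ adjIn (A ∪ B) u v ⟧) (λ u v → ⟦ adjIn (A ∩ B) u v ⟧))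
               (∑∑-mono-≤ pointwise)
    where
    pointwise : ∀ u v → ⟦ adjIn A u v ⟧ + ⟦ adjIn B u v ⟧ ≤ ⟦ adjIn (A ∪ B) u v ⟧ + ⟦ adjIn (A ∩ B) u v ⟧
    pointwise u v rewrite ∈ᵇ-∪ A B u | ∈ᵇ-∪ A B v | ∈ᵇ-∩ A B u | ∈ᵇ-∩ A B v =
      bool (adj G u v) (u ∈ᵇ A) (u ∈ᵇ B) (v ∈ᵇ A) (v ∈ᵇ B)
      where
      bool : ∀ a pu qu pv qv → ⟦ a ∧ pu ∧ pv ⟧ + ⟦ a ∧ qu ∧ qv ⟧
                             ≤ ⟦ a ∧ (pu ∨ qu) ∧ (pv ∨ qv) ⟧ + ⟦ a ∧ (pu ∧ qu) ∧ (pv ∧ qv) ⟧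
      bool false _     _     _     _     = z≤n
      bool true  true  true  true  _     = ≤-refl
      bool true  true  true  false qv    = m≤m+n ⟦ qv ⟧ 0
      bool true  true  false true  _     = ≤-refl
      bool true  true  false false _     = z≤n
      bool true  false true  _     false = z≤n
      bool true  false true  true  true  = s≤s z≤n
      bool true  false true  false true  = ≤-refl
      bool true  false false _     _     = z≤n

  edgesM₂-⊥ : (Y : Subset n) → edgesM₂ ⊥ Y ≡ 0
  edgesM₂-⊥ Y = ∑-zero (λ u → ∑-zero (no-pair u))
    where
    no-pair : ∀ u v → ⟦ adjM ⊥ Y u v ⟧ ≡ 0
    no-pair u v rewrite lookup-replicate u false | lookup-replicate v false = cong ⟦_⟧ (∧-zeroʳ (adj G u v))

  edgesM₂-∪ : {X X′ Y : Subset n} → X ∩ X′ ≡ ⊥ → X ∩ Y ≡ ⊥ → X′ ∩ Y ≡ ⊥ →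
              edgesM₂ (X ∪ X′) Y ≡ edgesM₂ X (X′ ∪ Y) + edgesM₂ X′ Y
  edgesM₂-∪ {X} {X′} {Y} X∩X′≡⊥ X∩Y≡⊥ X′∩Y≡⊥ = +-cancelʳ-≡ (edges₂ Y) _ _ (begin
    edgesM₂ (X ∪ X′) Y + edges₂ Y                    ≡⟨ edges₂-∪ ([p∪q]∩r≡⊥ X∩Y≡⊥ X′∩Y≡⊥) ⟨
    edges₂ ((X ∪ X′) ∪ Y)                            ≡⟨ cong edges₂ (∪-assoc X X′ Y) ⟩
    edges₂ (X ∪ (X′ ∪ Y))                            ≡⟨ edges₂-∪ (p∩[q∪r]≡⊥ X∩X′≡⊥ X∩Y≡⊥) ⟩
    edgesM₂ X (X′ ∪ Y) + edges₂ (X′ ∪ Y)             ≡⟨ cong (edgesM₂ X (X′ ∪ Y) +_) (edges₂-∪ X′∩Y≡⊥) ⟩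
    edgesM₂ X (X′ ∪ Y) + (edgesM₂ X′ Y + edges₂ Y)   ≡⟨ +-assoc (edgesM₂ X (X′ ∪ Y)) (edgesM₂ X′ Y) (edges₂ Y) ⟨
    edgesM₂ X (X′ ∪ Y) + edgesM₂ X′ Y + edges₂ Y     ∎)
    where open ≡-Reasoning

  edgesM₂-⁅⁆ : (x : Fin n) (Y : Subset n) → edgesM₂ ⁅ x ⁆ Y ≡ degIn G (⁅ x ⁆ ∪ Y) x + degIn G (⁅ x ⁆ ∪ Y) x
  edgesM₂-⁅⁆ x Y = begin
    edgesM₂ ⁅ x ⁆ Y                  ≡⟨ ∑∑-cong split ⟩
    ∑∑ (λ u v → at u v + at v u)     ≡⟨ ∑∑-distrib-+ at (λ u v → at v u) ⟩
    ∑∑ at + ∑∑ (λ u v → at v u)      ≡⟨ cong (∑∑ at +_) (∑-comm (λ u v → at v u)) ⟩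
    ∑∑ at + ∑∑ at                    ≡⟨ cong₂ _+_ ∑∑-at ∑∑-at ⟩
    degIn G S x + degIn G S x        ∎
    where
    open ≡-Reasoning
    S : Subset n
    S = ⁅ x ⁆ ∪ Y
    nbr : Fin n → Fin n → ℕ
    nbr u v = ⟦ adj G u v ∧ v ∈ᵇ S ⟧
    at : Fin n → Fin n → ℕ
    at u v = ⟦ u ∈ᵇ ⁅ x ⁆ ⟧ * nbr u v
    ∑∑-at : ∑∑ at ≡ degIn G S x
    ∑∑-at = begin
      ∑∑ at                                      ≡⟨ sum-cong-≗ (λ u → *-distribˡ-sum ⟦ u ∈ᵇ ⁅ x ⁆ ⟧ (nbr u)) ⟨
      ∑[ u < n ] (⟦ u ∈ᵇ ⁅ x ⁆ ⟧ * sum (nbr u))  ≡⟨ ∑-⁅⁆ x (λ u → sum (nbr u)) ⟩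
      sum (nbr x)                                ≡⟨ sum-cong-≗ (λ v → cong ⟦_⟧ (∧-comm (adj G x v) (v ∈ᵇ S))) ⟩
      ∑[ v < n ] ⟦ v ∈ᵇ S ∧ adj G x v ⟧          ≡⟨ degIn≡∑ S x ⟨
      degIn G S x                                ∎
    no-loop : ∀ u v → u ∈ᵇ ⁅ x ⁆ ∧ v ∈ᵇ ⁅ x ⁆ ∧ adj G u v ≡ false
    no-loop u v with u ∈ᵇ ⁅ x ⁆ in u∈x | v ∈ᵇ ⁅ x ⁆ in v∈x
    ... | false | _     = refl
    ... | true  | false = refl
    ... | true  | true  = trans (cong₂ (adj G) (∈ᵇ-⁅⁆⇒≡ u∈x) (∈ᵇ-⁅⁆⇒≡ v∈x)) (irrefl G x)
    split : ∀ u v → ⟦ adjM ⁅ x ⁆ Y u v ⟧ ≡ at u v + at v u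
    split u v rewrite Graph.sym G v u =
      bool (adj G u v) (u ∈ᵇ ⁅ x ⁆) (v ∈ᵇ ⁅ x ⁆) (u ∈ᵇ S) (v ∈ᵇ S) (no-loop u v)
      where
      bool : ∀ a xu xv su sv → xu ∧ xv ∧ a ≡ false →
             ⟦ a ∧ ((xu ∧ sv) ∨ (xv ∧ su)) ⟧ ≡ ⟦ xu ⟧ * ⟦ a ∧ sv ⟧ + ⟦ xv ⟧ * ⟦ a ∧ su ⟧
      bool false xu    xv    _  _     _  = sym (cong₂ _+_ (*-zeroʳ ⟦ xu ⟧) (*-zeroʳ ⟦ xv ⟧))
      bool true  false xv    su _     _  = ⟦∧⟧ xv su
      bool true  true  false _  true  _  = refl
      bool true  true  false _  false _  = refl
      bool true  true  true  _  _     ()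

  ∑-degIn≤edgesM₂ : {X Y S : Subset n} → S ⊆ X ∪ Y → ∑[ u < n ] (⟦ u ∈ᵇ X ⟧ * degIn G S u) ≤ edgesM₂ X Y
  ∑-degIn≤edgesM₂ {X} {Y} {S} S⊆X∪Y = begin
    ∑[ u < n ] (⟦ u ∈ᵇ X ⟧ * degIn G S u)
      ≡⟨ sum-cong-≗ (λ u → cong (⟦ u ∈ᵇ X ⟧ *_) (degIn≡∑ S u)) ⟩
    ∑[ u < n ] (⟦ u ∈ᵇ X ⟧ * ∑[ v < n ] ⟦ v ∈ᵇ S ∧ adj G u v ⟧)
      ≡⟨ sum-cong-≗ (λ u → *-distribˡ-sum ⟦ u ∈ᵇ X ⟧ (λ v → ⟦ v ∈ᵇ S ∧ adj G u v ⟧)) ⟩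
    ∑∑ (λ u v → ⟦ u ∈ᵇ X ⟧ * ⟦ v ∈ᵇ S ∧ adj G u v ⟧)
      ≡⟨ ∑∑-cong (λ u v → ⟦∧⟧ (u ∈ᵇ X) (v ∈ᵇ S ∧ adj G u v)) ⟨
    ∑∑ (λ u v → ⟦ u ∈ᵇ X ∧ v ∈ᵇ S ∧ adj G u v ⟧)
      ≤⟨ ∑∑-mono-≤ pointwise ⟩
    edgesM₂ X Y
      ∎
    where
    open ≤-Reasoning
    pointwise : ∀ u v → ⟦ u ∈ᵇ X ∧ v ∈ᵇ S ∧ adj G u v ⟧ ≤ ⟦ adjM X Y u v ⟧
    pointwise u v with u ∈ᵇ X | v ∈ᵇ S in v∈S
    ... | false | _     = z≤n
    ... | true  | false = z≤n
    ... | true  | true rewrite ⊆⇒∈ᵇ S⊆X∪Y v v∈S with adj G u v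
    ...   | false = z≤n
    ...   | true  = ≤-refl

  dens-≤⇔ : {X Y X′ Y′ : Subset n} → Nonempty (X ─ Y) → Nonempty (X′ ─ Y′) →
            dens G X Y ≤ℚ dens G X′ Y′ ⇔ edgesM₂ (X ─ Y) Y / ∣ X ─ Y ∣ ≼ edgesM₂ (X′ ─ Y′) Y′ / ∣ X′ ─ Y′ ∣
  dens-≤⇔ {X} {Y} {X′} {Y′} X─Y≢∅ X′─Y′≢∅
    with ∣ X ─ Y ∣ | ∣ X′ ─ Y′ ∣ | Nonempty⇒0<∣∣ X─Y≢∅ | Nonempty⇒0<∣∣ X′─Y′≢∅
  ... | suc k | suc l | _ | _ rewrite sym (edgesM-double (X ─ Y) Y) | sym (edgesM-double (X′ ─ Y′) Y′)
    = mk⇔ (Equivalence.from (double-≼⇔ {e} {e′}) ∘ Equivalence.to (mkℚᵘ-≤⇔ {e} {k} {e′} {l}))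
          (Equivalence.from (mkℚᵘ-≤⇔ {e} {k} {e′} {l}) ∘ Equivalence.to (double-≼⇔ {e} {e′}))
    where
    e e′ : ℕ
    e  = edgesM G (X ─ Y) Y
    e′ = edgesM G (X′ ─ Y′) Y′

  dens*½-≤ : {X Y X′ Y′ : Subset n} → Nonempty (X ─ Y) → Nonempty (X′ ─ Y′) →
             edgesM₂ (X ─ Y) Y / (∣ X ─ Y ∣ * 2) ≼ edgesM₂ (X′ ─ Y′) Y′ / ∣ X′ ─ Y′ ∣ →
             dens G X Y *ℚ ½ ≤ℚ dens G X′ Y′
  dens*½-≤ {X} {Y} {X′} {Y′} X─Y≢∅ X′─Y′≢∅ le
    with ∣ X ─ Y ∣ | ∣ X′ ─ Y′ ∣ | Nonempty⇒0<∣∣ X─Y≢∅ | Nonempty⇒0<∣∣ X′─Y′≢∅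
  ... | suc k | suc l | _ | _ rewrite sym (edgesM-double (X ─ Y) Y) | sym (edgesM-double (X′ ─ Y′) Y′)
    = mkℚᵘ-*½-≤ {e} {k} {e′} {l} (Equivalence.to (double-≼⇔ {e} {e′}) le)
    where
    e e′ : ℕ
    e  = edgesM G (X ─ Y) Y
    e′ = edgesM G (X′ ─ Y′) Y′

  dens-≤⇔-disjoint : {X Y X′ Y′ : Subset n} → X ∩ Y ≡ ⊥ → X′ ∩ Y′ ≡ ⊥ → Nonempty X → Nonempty X′ →
                     dens G X Y ≤ℚ dens G X′ Y′ ⇔ edgesM₂ X Y / ∣ X ∣ ≼ edgesM₂ X′ Y′ / ∣ X′ ∣
  dens-≤⇔-disjoint {X} {Y} {X′} {Y′} X∩Y≡⊥ X′∩Y′≡⊥ X≢∅ X′≢∅ =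
    subst₂ (λ A A′ → dens G X Y ≤ℚ dens G X′ Y′ ⇔ edgesM₂ A Y / ∣ A ∣ ≼ edgesM₂ A′ Y′ / ∣ A′ ∣)
           X─Y≡X X′─Y′≡X′ (dens-≤⇔ (subst Nonempty (sym X─Y≡X) X≢∅) (subst Nonempty (sym X′─Y′≡X′) X′≢∅))
    where
    X─Y≡X : X ─ Y ≡ X
    X─Y≡X = p∩q≡⊥⇒p─q≡p X∩Y≡⊥
    X′─Y′≡X′ : X′ ─ Y′ ≡ X′
    X′─Y′≡X′ = p∩q≡⊥⇒p─q≡p X′∩Y′≡⊥

  LocallyDense⇒≼ : {W X Y : Subset n} → LocallyDense G W → X ⊆ W → Y ∩ W ≡ ⊥ →
                   edgesM₂ Y W / ∣ Y ∣ ≼ edgesM₂ X (W ─ X) / ∣ X ∣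
  LocallyDense⇒≼ {W} {X} {Y} W-dense X⊆W Y∩W≡⊥ with nonempty? X | nonempty? Y
  ... | no X≡∅ | _      rewrite Empty-unique X≡∅ | ∣⊥∣≡0 n | *-zeroʳ (edgesM₂ Y W) = z≤n
  ... | yes _  | no Y≡∅ rewrite Empty-unique Y≡∅ | edgesM₂-⊥ W = z≤n
  ... | yes X≢∅ | yes Y≢∅ with ℚ.≤-total (dens G X (W ─ X)) (dens G Y W)
  ...   | inj₁ X-sparser = ⊥-elim (W-dense (X , Y , X⊆W , X≢∅ , Y≢∅ , Y∩W≡⊥ , X-sparser))
  ...   | inj₂ Y-sparser =
    Equivalence.to (dens-≤⇔-disjoint Y∩W≡⊥ (trans (∩-comm X (W ─ X)) ([p─q]∩q≡⊥ W X)) Y≢∅ X≢∅) Y-sparser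

  LocallyDense⁺ : {W : Subset n} →
                  (∀ {X Y} → X ⊆ W → Nonempty X → Nonempty Y → Y ∩ W ≡ ⊥ →
                     edgesM₂ Y W / ∣ Y ∣ ≺ edgesM₂ X (W ─ X) / ∣ X ∣) →
                  LocallyDense G W
  LocallyDense⁺ {W} denser (X , Y , X⊆W , X≢∅ , Y≢∅ , Y∩W≡⊥ , X-sparser) =
    <⇒≱ (denser X⊆W X≢∅ Y≢∅ Y∩W≡⊥)
        (Equivalence.to (dens-≤⇔-disjoint (trans (∩-comm X (W ─ X)) ([p─q]∩q≡⊥ W X)) Y∩W≡⊥ X≢∅ Y≢∅) X-sparser)

-- Two consecutive locally dense sets W ⊊ B

module ConsecutiveLocallyDense (G : Graph n) {W B : Subset n}
  (W-dense : LocallyDense G W) (B-dense : LocallyDense G B) (W⊆B : W ⊆ B) (D≢∅ : Nonempty (B ─ W))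
  (dichotomy : ∀ T → LocallyDense G T → T ⊆ W ⊎ B ⊆ T) where

  D : Subset n
  D = B ─ W

  D∩W≡⊥ : D ∩ W ≡ ⊥
  D∩W≡⊥ = [p─q]∩q≡⊥ B W

  D∪W≡B : D ∪ W ≡ B
  D∪W≡B = trans (∪-comm D W) (p⊆q⇒p∪[q─p]≡q W⊆B)

  mW : Subset n → ℕ
  mW Y = edgesM₂ G Y W

  Outside : Subset n → Set
  Outside Y = Nonempty Y × Y ∩ W ≡ ⊥

  outside? : Decidable Outside
  outside? Y = nonempty? Y ×-dec ≡-dec _≟ᵇ_ (Y ∩ W) ⊥

  -- M is a densest set outside W of maximal size: maximality of the density keeps sets outside
  -- M ∪ W sparse, maximality of the size makes them strictly sparser.
  private opaque
    densest : ∃ λ Y₀ → Outside Y₀ × (∀ {Y} → Outside Y → dens G Y W ≤ℚ dens G Y₀ W)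
    densest = maximiser (subsets n) ∈-subsets ℚ.≤-totalOrder outside? (λ Y → dens G Y W) (D , D≢∅ , D∩W≡⊥)

  private
    Y₀ : Subset n
    Y₀ = proj₁ densest

    AsDense : Subset n → Set
    AsDense Y = Outside Y × dens G Y₀ W ≤ℚ dens G Y W

    asDense? : Decidable AsDense
    asDense? Y = outside? Y ×-dec dens G Y₀ W ℚ.≤? dens G Y W

  private opaque
    largest : ∃ λ M → AsDense M × (∀ {Y} → AsDense Y → ∣ Y ∣ ≤ ∣ M ∣)
    largest = maximiser (subsets n) ∈-subsets ≤-totalOrder asDense? ∣_∣ (Y₀ , proj₁ (proj₂ densest) , ℚ.≤-refl)

  M : Subset n
  M = proj₁ largest

  M-outside : Outside M
  M-outside = proj₁ (proj₁ (proj₂ largest))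

  M∩W≡⊥ : M ∩ W ≡ ⊥
  M∩W≡⊥ = proj₂ M-outside

  M-densest : {Y : Subset n} → Y ∩ W ≡ ⊥ → mW Y / ∣ Y ∣ ≼ mW M / ∣ M ∣
  M-densest {Y} Y∩W≡⊥ with nonempty? Y
  ... | no Y≡∅ rewrite Empty-unique Y≡∅ | edgesM₂-⊥ G W = z≤n
  ... | yes Y≢∅ = Equivalence.to (dens-≤⇔-disjoint G Y∩W≡⊥ M∩W≡⊥ Y≢∅ (proj₁ M-outside))
    (ℚ.≤-trans (proj₂ (proj₂ densest) (Y≢∅ , Y∩W≡⊥)) (proj₂ (proj₁ (proj₂ largest))))

  M-largest : {Y : Subset n} → Outside Y → mW M / ∣ M ∣ ≼ mW Y / ∣ Y ∣ → ∣ Y ∣ ≤ ∣ M ∣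
  M-largest {Y} (Y≢∅ , Y∩W≡⊥) M-sparser = proj₂ (proj₂ largest) ((Y≢∅ , Y∩W≡⊥) ,
    ℚ.≤-trans (proj₂ (proj₁ (proj₂ largest)))
              (Equivalence.from (dens-≤⇔-disjoint G M∩W≡⊥ Y∩W≡⊥ (proj₁ M-outside) Y≢∅) M-sparser))

  outside-M∪W-sparser : {Z : Subset n} → Nonempty Z → Z ∩ (M ∪ W) ≡ ⊥ →
                        edgesM₂ G Z (M ∪ W) / ∣ Z ∣ ≺ mW M / ∣ M ∣
  outside-M∪W-sparser {Z} Z≢∅ Z∩M∪W≡⊥ = mediant-≺⁻ {edgesM₂ G Z (M ∪ W)} {∣ Z ∣} {mW M} {∣ M ∣}
    (subst₂ (λ m s → m / s ≺ mW M / ∣ M ∣) mW-Z∪M ∣Z∪M∣ Z∪M-sparser)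
    where
    Z∩M≡⊥ : Z ∩ M ≡ ⊥
    Z∩M≡⊥ = ∩≡⊥-mono ⊆-refl (p⊆p∪q W) Z∩M∪W≡⊥
    Z∩W≡⊥ : Z ∩ W ≡ ⊥
    Z∩W≡⊥ = ∩≡⊥-mono ⊆-refl (q⊆p∪q M W) Z∩M∪W≡⊥
    mW-Z∪M : mW (Z ∪ M) ≡ edgesM₂ G Z (M ∪ W) + mW M
    mW-Z∪M = edgesM₂-∪ G Z∩M≡⊥ Z∩W≡⊥ M∩W≡⊥
    ∣Z∪M∣ : ∣ Z ∪ M ∣ ≡ ∣ Z ∣ + ∣ M ∣
    ∣Z∪M∣ = ∣p∪q∣≡∣p∣+∣q∣ Z∩M≡⊥
    Z∪M-sparser : mW (Z ∪ M) / ∣ Z ∪ M ∣ ≺ mW M / ∣ M ∣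
    Z∪M-sparser = ≰⇒> λ M-sparser → <⇒≱
      (subst (∣ M ∣ <_) (sym ∣Z∪M∣) (m<n+m ∣ M ∣ (Nonempty⇒0<∣∣ Z≢∅)))
      (M-largest (map₂ (p⊆p∪q M) Z≢∅ , [p∪q]∩r≡⊥ Z∩W≡⊥ M∩W≡⊥) M-sparser)

  supermodular-exchange : {X : Subset n} → X ⊆ M ∪ W →
    mW M + edgesM₂ G (W ∩ X) (W ─ (W ∩ X)) ≤ edgesM₂ G X ((M ∪ W) ─ X) + mW (M ─ X)
  supermodular-exchange {X} X⊆M∪W = +-exchange split-M∪W split-complement split-W
    where
    X₁ K V : Subset n
    X₁ = W ∩ X
    K  = W ─ X₁
    V  = M ─ X
    V∩W≡⊥ : V ∩ W ≡ ⊥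
    V∩W≡⊥ = ∩≡⊥-mono (p─q⊆p M X) ⊆-refl M∩W≡⊥
    K⊆W : K ⊆ W
    K⊆W = p─q⊆p W X₁
    split-M∪W : mW M + edges₂ G W ≡ edgesM₂ G X ((M ∪ W) ─ X) + edges₂ G ((M ∪ W) ─ X)
    split-M∪W = begin
      mW M + edges₂ G W                                   ≡⟨ edges₂-∪ G M∩W≡⊥ ⟨
      edges₂ G (M ∪ W)                                    ≡⟨ cong (edges₂ G) (p⊆q⇒p∪[q─p]≡q X⊆M∪W) ⟨
      edges₂ G (X ∪ ((M ∪ W) ─ X))                        ≡⟨ edges₂-∪ G (trans (∩-comm X _) ([p─q]∩q≡⊥ (M ∪ W) X)) ⟩
      edgesM₂ G X ((M ∪ W) ─ X) + edges₂ G ((M ∪ W) ─ X)  ∎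
      where open ≡-Reasoning
    split-complement : edges₂ G ((M ∪ W) ─ X) + edges₂ G W ≤ mW V + edges₂ G W + edges₂ G K
    split-complement = begin
      edges₂ G ((M ∪ W) ─ X) + edges₂ G W                  ≡⟨ cong (λ S → edges₂ G S + edges₂ G W) M∪W─X≡V∪K ⟩
      edges₂ G (V ∪ K) + edges₂ G W                        ≤⟨ edges₂-supermodular G (V ∪ K) W ⟩
      edges₂ G ((V ∪ K) ∪ W) + edges₂ G ((V ∪ K) ∩ W)      ≡⟨ cong₂ (λ S S′ → edges₂ G S + edges₂ G S′) V∪K∪W≡V∪W V∪K∩W≡K ⟩
      edges₂ G (V ∪ W) + edges₂ G K                        ≡⟨ cong (_+ edges₂ G K) (edges₂-∪ G V∩W≡⊥) ⟩
      mW V + edges₂ G W + edges₂ G K                       ∎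
      where
      open ≤-Reasoning
      M∪W─X≡V∪K : (M ∪ W) ─ X ≡ V ∪ K
      M∪W─X≡V∪K = trans ([p∪q]─r≡[p─r]∪[q─r] M W X) (cong (V ∪_) (sym (p─[p∩q]≡p─q W X)))
      V∪K∪W≡V∪W : (V ∪ K) ∪ W ≡ V ∪ W
      V∪K∪W≡V∪W = trans (∪-assoc V K W) (cong (V ∪_) (p⊆q⇒p∪q≡q K⊆W))
      V∪K∩W≡K : (V ∪ K) ∩ W ≡ K
      V∪K∩W≡K = trans (∩-distribʳ-∪ W V K) (trans (cong₂ _∪_ V∩W≡⊥ (p⊆q⇒p∩q≡p K⊆W)) (∪-identityˡ K))
    split-W : edges₂ G W ≡ edgesM₂ G X₁ K + edges₂ G K
    split-W = trans (cong (edges₂ G) (sym (p⊆q⇒p∪[q─p]≡q (p∩q⊆p W X))))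
                    (edges₂-∪ G (trans (∩-comm X₁ K) ([p─q]∩q≡⊥ W X₁)))

  inside-M∪W-denser : {X : Subset n} → X ⊆ M ∪ W → mW M / ∣ M ∣ ≼ edgesM₂ G X ((M ∪ W) ─ X) / ∣ X ∣
  inside-M∪W-denser {X} X⊆M∪W =
    exchange {mW M} {edgesM₂ G (W ∩ X) (W ─ (W ∩ X))} {edgesM₂ G X ((M ∪ W) ─ X)} {mW (M ─ X)}
             {∣ X ∣} {∣ W ∩ X ∣} {∣ M ∩ X ∣} {∣ M ∣} {∣ M ─ X ∣}
      (supermodular-exchange X⊆M∪W)
      (LocallyDense⇒≼ G W-dense (p∩q⊆p W X) M∩W≡⊥)
      (M-densest (∩≡⊥-mono (p─q⊆p M X) ⊆-refl M∩W≡⊥))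
      (sym (∣p─q∣+∣p∩q∣≡∣p∣ M X))
      ∣X∣-split
    where
    ∣X∣-split : ∣ X ∣ ≡ ∣ M ∩ X ∣ + ∣ W ∩ X ∣
    ∣X∣-split = begin
      ∣ X ∣                  ≡⟨ cong ∣_∣ (trans (∩-comm (M ∪ W) X) (p⊆q⇒p∩q≡p X⊆M∪W)) ⟨
      ∣ (M ∪ W) ∩ X ∣        ≡⟨ cong ∣_∣ (∩-distribʳ-∪ X M W) ⟩
      ∣ (M ∩ X) ∪ (W ∩ X) ∣  ≡⟨ ∣p∪q∣≡∣p∣+∣q∣ (∩≡⊥-mono (p∩q⊆p M X) (p∩q⊆p W X) M∩W≡⊥) ⟩
      ∣ M ∩ X ∣ + ∣ W ∩ X ∣  ∎
      where open ≡-Reasoning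

  M∪W-dense : LocallyDense G (M ∪ W)
  M∪W-dense = LocallyDense⁺ G λ {X} {Z} X⊆M∪W X≢∅ Z≢∅ Z∩M∪W≡⊥ →
    ≺-≼-trans {edgesM₂ G Z (M ∪ W)} {∣ Z ∣} {mW M} {∣ M ∣} {edgesM₂ G X ((M ∪ W) ─ X)} {∣ X ∣}
      (Nonempty⇒0<∣∣ X≢∅) (outside-M∪W-sparser Z≢∅ Z∩M∪W≡⊥) (inside-M∪W-denser X⊆M∪W)

  D⊆M : D ⊆ M
  D⊆M {x} x∈D with dichotomy (M ∪ W) M∪W-dense
  ... | inj₁ M∪W⊆W = let (_ , y∈M) = proj₁ M-outside in ⊥-elim (∩≡⊥⇒∉ M∩W≡⊥ y∈M (M∪W⊆W (p⊆p∪q W y∈M)))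
  ... | inj₂ B⊆M∪W = [ (λ x∈M → x∈M) , (λ x∈W → ⊥-elim (∩≡⊥⇒∉ D∩W≡⊥ x∈D x∈W)) ]′
                       (x∈p∪q⁻ M W (B⊆M∪W (p─q⊆p B W x∈D)))

  M-sparser-than-D : mW M / ∣ M ∣ ≼ mW D / ∣ D ∣
  M-sparser-than-D = subst₂ (λ m s → m / s ≼ mW D / ∣ D ∣) mW-M ∣M∣
    (mediant-≼ {edgesM₂ G Z B} {∣ Z ∣} {mW D} {∣ D ∣} Z-sparser)
    where
    Z : Subset n
    Z = M ─ D
    Z∩D≡⊥ : Z ∩ D ≡ ⊥
    Z∩D≡⊥ = [p─q]∩q≡⊥ M D
    Z∩W≡⊥ : Z ∩ W ≡ ⊥
    Z∩W≡⊥ = ∩≡⊥-mono (p─q⊆p M D) ⊆-refl M∩W≡⊥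
    Z∪D≡M : Z ∪ D ≡ M
    Z∪D≡M = trans (∪-comm Z D) (p⊆q⇒p∪[q─p]≡q D⊆M)
    Z-sparser : edgesM₂ G Z B / ∣ Z ∣ ≼ mW D / ∣ D ∣
    Z-sparser = subst (λ S → edgesM₂ G Z B / ∣ Z ∣ ≼ edgesM₂ G D S / ∣ D ∣) (q⊆p⇒p─[p─q]≡q W⊆B)
      (LocallyDense⇒≼ G B-dense (p─q⊆p B W) (subst (λ S → Z ∩ S ≡ ⊥) D∪W≡B (p∩[q∪r]≡⊥ Z∩D≡⊥ Z∩W≡⊥)))
    mW-M : edgesM₂ G Z B + mW D ≡ mW M
    mW-M = begin
      edgesM₂ G Z B + mW D        ≡⟨ cong (λ S → edgesM₂ G Z S + mW D) D∪W≡B ⟨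
      edgesM₂ G Z (D ∪ W) + mW D  ≡⟨ edgesM₂-∪ G Z∩D≡⊥ Z∩W≡⊥ D∩W≡⊥ ⟨
      mW (Z ∪ D)                  ≡⟨ cong mW Z∪D≡M ⟩
      mW M                        ∎
      where open ≡-Reasoning
    ∣M∣ : ∣ Z ∣ + ∣ D ∣ ≡ ∣ M ∣
    ∣M∣ = trans (sym (∣p∪q∣≡∣p∣+∣q∣ Z∩D≡⊥)) (cong ∣_∣ Z∪D≡M)

  D-densest : {Y : Subset n} → Y ∩ W ≡ ⊥ → mW Y / ∣ Y ∣ ≼ mW D / ∣ D ∣
  D-densest {Y} Y∩W≡⊥ = ≼-trans {mW Y} {∣ Y ∣} {mW M} {∣ M ∣} {mW D} {∣ D ∣}
    (Nonempty⇒0<∣∣ (proj₁ M-outside)) (M-densest Y∩W≡⊥) M-sparser-than-D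

  W-vertex-bound : {x : Fin n} → x ∈ₛ W → mW D ≤ (degIn G W x + degIn G W x) * ∣ D ∣
  W-vertex-bound {x} x∈W = begin
    mW D                                ≡⟨ trans (sym (*-identityʳ (mW D))) (cong (mW D *_) (sym (∣⁅x⁆∣≡1 x))) ⟩
    mW D * ∣ ⁅ x ⁆ ∣                     ≤⟨ LocallyDense⇒≼ G W-dense ⁅x⁆⊆W D∩W≡⊥ ⟩
    edgesM₂ G ⁅ x ⁆ (W ─ ⁅ x ⁆) * ∣ D ∣   ≡⟨ cong (_* ∣ D ∣) (edgesM₂-⁅⁆ G x (W ─ ⁅ x ⁆)) ⟩
    (deg (⁅ x ⁆ ∪ (W ─ ⁅ x ⁆)) + deg (⁅ x ⁆ ∪ (W ─ ⁅ x ⁆))) * ∣ D ∣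
                                        ≡⟨ cong (λ S → (deg S + deg S) * ∣ D ∣) (p⊆q⇒p∪[q─p]≡q ⁅x⁆⊆W) ⟩
    (deg W + deg W) * ∣ D ∣              ∎
    where
    open ≤-Reasoning
    deg : Subset n → ℕ
    deg S = degIn G S x
    ⁅x⁆⊆W : ⁅ x ⁆ ⊆ W
    ⁅x⁆⊆W = x∈p⇒⁅x⁆⊆p x∈W

  D-vertex-bound : {x : Fin n} → x ∈ₛ D → mW D ≤ (degIn G B x + degIn G B x) * ∣ D ∣
  D-vertex-bound {x} x∈D = subst₂ _≤_ (trans (*-identityʳ _) mW-D) (cong ((deg B + deg B) *_) ∣D∣)
    (≼-mediant⇒mediant-≼ {deg B + deg B} {1} {mW D′} {∣ D′ ∣}
      (subst₂ (λ s m → mW D′ / ∣ D′ ∣ ≼ m / s) (sym ∣D∣) (sym mW-D) (D-densest D′∩W≡⊥)))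
    where
    deg : Subset n → ℕ
    deg S = degIn G S x
    D′ : Subset n
    D′ = D ─ ⁅ x ⁆
    ⁅x⁆⊆D : ⁅ x ⁆ ⊆ D
    ⁅x⁆⊆D = x∈p⇒⁅x⁆⊆p x∈D
    ⁅x⁆∩D′≡⊥ : ⁅ x ⁆ ∩ D′ ≡ ⊥
    ⁅x⁆∩D′≡⊥ = trans (∩-comm ⁅ x ⁆ D′) ([p─q]∩q≡⊥ D ⁅ x ⁆)
    D′∩W≡⊥ : D′ ∩ W ≡ ⊥
    D′∩W≡⊥ = ∩≡⊥-mono (p─q⊆p D ⁅ x ⁆) ⊆-refl D∩W≡⊥
    ⁅x⁆∪D′≡D : ⁅ x ⁆ ∪ D′ ≡ D
    ⁅x⁆∪D′≡D = p⊆q⇒p∪[q─p]≡q ⁅x⁆⊆D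
    mW-D : deg B + deg B + mW D′ ≡ mW D
    mW-D = begin
      deg B + deg B + mW D′                                     ≡⟨ cong (λ S → deg S + deg S + mW D′) ⁅x⁆∪D′∪W≡B ⟨
      deg (⁅ x ⁆ ∪ (D′ ∪ W)) + deg (⁅ x ⁆ ∪ (D′ ∪ W)) + mW D′   ≡⟨ cong (_+ mW D′) (edgesM₂-⁅⁆ G x (D′ ∪ W)) ⟨
      edgesM₂ G ⁅ x ⁆ (D′ ∪ W) + mW D′                          ≡⟨ edgesM₂-∪ G ⁅x⁆∩D′≡⊥ (∩≡⊥-mono ⁅x⁆⊆D ⊆-refl D∩W≡⊥) D′∩W≡⊥ ⟨
      mW (⁅ x ⁆ ∪ D′)                                           ≡⟨ cong mW ⁅x⁆∪D′≡D ⟩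
      mW D                                                      ∎
      where
      open ≡-Reasoning
      ⁅x⁆∪D′∪W≡B : ⁅ x ⁆ ∪ (D′ ∪ W) ≡ B
      ⁅x⁆∪D′∪W≡B = trans (sym (∪-assoc ⁅ x ⁆ D′ W)) (trans (cong (_∪ W) ⁅x⁆∪D′≡D) D∪W≡B)
    ∣D∣ : 1 + ∣ D′ ∣ ≡ ∣ D ∣
    ∣D∣ = trans (cong (_+ ∣ D′ ∣) (sym (∣⁅x⁆∣≡1 x))) (trans (sym (∣p∪q∣≡∣p∣+∣q∣ ⁅x⁆∩D′≡⊥)) (cong ∣_∣ ⁅x⁆∪D′≡D))

  B-vertex-bound : {x : Fin n} → x ∈ₛ B → mW D ≤ (degIn G B x + degIn G B x) * ∣ D ∣
  B-vertex-bound {x} x∈B with x ∈? W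
  ... | yes x∈W = ≤-trans (W-vertex-bound x∈W) (*-monoˡ-≤ ∣ D ∣ (+-mono-≤ degW≤degB degW≤degB))
    where
    degW≤degB : degIn G W x ≤ degIn G B x
    degW≤degB = degIn-mono G W⊆B x
  ... | no x∉W = D-vertex-bound (x∈p∧x∉q⇒x∈p─q x∈B x∉W)

  dens*½≤dens : {P R : Subset n} {x : Fin n} → B ⊆ P → x ∈ₛ B →
                (∀ {u} → u ∈ₛ P → degIn G P x ≤ degIn G P u) → Nonempty (P ─ R) →
                dens G B W *ℚ ½ ≤ℚ dens G P R
  dens*½≤dens {P} {R} {x} B⊆P x∈B x-min P─R≢∅ = dens*½-≤ G D≢∅ P─R≢∅ (begin
    mW D * ∣ P ─ R ∣                                           ≤⟨ *∣∣≤*∑ {k = ∣ D ∣ * 2} (degIn G P) bound ⟩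
    (∣ D ∣ * 2) * ∑[ u < n ] (⟦ u ∈ᵇ (P ─ R) ⟧ * degIn G P u)  ≤⟨ *-monoʳ-≤ (∣ D ∣ * 2) (∑-degIn≤edgesM₂ G P⊆[P─R]∪R) ⟩
    (∣ D ∣ * 2) * edgesM₂ G (P ─ R) R                          ≡⟨ *-comm (∣ D ∣ * 2) _ ⟩
    edgesM₂ G (P ─ R) R * (∣ D ∣ * 2)                          ∎)
    where
    open ≤-Reasoning
    P⊆[P─R]∪R : P ⊆ (P ─ R) ∪ R
    P⊆[P─R]∪R {u} u∈P with u ∈? R
    ... | yes u∈R = q⊆p∪q (P ─ R) R u∈R
    ... | no  u∉R = p⊆p∪q R (x∈p∧x∉q⇒x∈p─q u∈P u∉R)
    bound : ∀ {u} → u ∈ₛ P ─ R → mW D ≤ (∣ D ∣ * 2) * degIn G P u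
    bound {u} u∈P─R = begin
      mW D                                 ≤⟨ B-vertex-bound x∈B ⟩
      (degIn G B x + degIn G B x) * ∣ D ∣  ≤⟨ *-monoˡ-≤ ∣ D ∣ (+-mono-≤ x≤u x≤u) ⟩
      (degIn G P u + degIn G P u) * ∣ D ∣  ≡⟨ reorder (degIn G P u) ∣ D ∣ ⟩
      (∣ D ∣ * 2) * degIn G P u            ∎
      where
      x≤u : degIn G B x ≤ degIn G P u
      x≤u = ≤-trans (degIn-mono G B⊆P x) (x-min (p─q⊆p P R u∈P─R))
      reorder : ∀ g d → (g + g) * d ≡ (d * 2) * g
      reorder = solve-∀

-- The greedy peeling order

T⇔T⇒≡ : {a b : Bool} → (T a → T b) → (T b → T a) → a ≡ b
T⇔T⇒≡ {false} {false} _   _   = refl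
T⇔T⇒≡ {false} {true}  _   b⇒a = ⊥-elim (b⇒a _)
T⇔T⇒≡ {true}  {false} a⇒b _   = ⊥-elim (a⇒b _)
T⇔T⇒≡ {true}  {true}  _   _   = refl

module Prefix {w : Fin n → Fin n} (w-bij : Bijective _≡_ _≡_ w) where

  position : Fin n → Fin n
  position v = proj₁ (proj₂ w-bij v)

  w∘position : ∀ v → w (position v) ≡ v
  w∘position v = proj₂ (proj₂ w-bij v) refl

  position∘w : ∀ k → position (w k) ≡ k
  position∘w k = proj₁ w-bij (w∘position (w k))

  ∈ᵇ-prefix : (i : ℕ) (v : Fin n) → v ∈ᵇ prefix w i ≡ (toℕ (position v) <ᵇ i)
  ∈ᵇ-prefix i v = trans (lookup∘tabulate _ v) (T⇔T⇒≡ listed⇒early early⇒listed)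
    where
    listed : Fin n → Bool
    listed k = (toℕ k <ᵇ i) ∧ does (w k F.≟ v)
    listed⇒early : T (any listed (allFin n)) → T (toℕ (position v) <ᵇ i)
    listed⇒early any-listed with satisfied (any⁻ listed (allFin n) any-listed)
    ... | k , k-listed with w k F.≟ v
    ...   | yes refl rewrite position∘w k = proj₁ (Equivalence.to T-∧ k-listed)
    ...   | no  _    = ⊥-elim (proj₂ (Equivalence.to T-∧ k-listed))
    early⇒listed : T (toℕ (position v) <ᵇ i) → T (any listed (allFin n))
    early⇒listed early = any⁺ listed (lose (∈-allFin (position v)) position-listed)
      where
      position-listed : T (listed (position v))
      position-listed with w (position v) F.≟ v
      ... | yes _       = Equivalence.from T-∧ (early , _)
      ... | no  w∘pos≢v = ⊥-elim (w∘pos≢v (w∘position v))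

  ∈-prefix⇔ : {i : ℕ} {v : Fin n} → v ∈ₛ prefix w i ⇔ toℕ (position v) < i
  ∈-prefix⇔ {i} {v} = mk⇔
    (λ v∈ → <ᵇ⇒< _ i (Equivalence.from T-≡ (trans (sym (∈ᵇ-prefix i v)) (∈⇒∈ᵇ v∈))))
    (λ pos<i → ∈ᵇ⇒∈ (trans (∈ᵇ-prefix i v) (Equivalence.to T-≡ (<⇒<ᵇ pos<i))))

  prefix-⊆ : {i j : ℕ} → i ≤ j → prefix w i ⊆ prefix w j
  prefix-⊆ i≤j v∈ = Equivalence.from ∈-prefix⇔ (<-≤-trans (Equivalence.to ∈-prefix⇔ v∈) i≤j)

  prefix-0 : prefix w 0 ≡ ⊥
  prefix-0 = Empty-unique λ (_ , v∈) → n≮0 (Equivalence.to ∈-prefix⇔ v∈)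

  ∣prefix∣ : {i : ℕ} → i ≤ n → ∣ prefix w i ∣ ≡ i
  ∣prefix∣ {i} i≤n = begin
    ∣ prefix w i ∣                            ≡⟨ ∣∣≡∑ (prefix w i) ⟩
    ∑[ v < n ] ⟦ v ∈ᵇ prefix w i ⟧            ≡⟨ sum-cong-≗ (λ v → cong ⟦_⟧ (∈ᵇ-prefix i v)) ⟩
    ∑[ v < n ] ⟦ toℕ (position v) <ᵇ i ⟧       ≡⟨ sum-permute _ (permutation w position w∘position position∘w) ⟩
    ∑[ k < n ] ⟦ toℕ (position (w k)) <ᵇ i ⟧   ≡⟨ sum-cong-≗ (λ k → cong (λ j → ⟦ toℕ j <ᵇ i ⟧) (position∘w k)) ⟩
    ∑[ k < n ] ⟦ toℕ k <ᵇ i ⟧                  ≡⟨ ∑-<ᵇ i≤n ⟩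
    i                                         ∎
    where open ≡-Reasoning

  latest : (B : Subset n) → Nonempty B → ∃ λ x → x ∈ₛ B × B ⊆ prefix w (suc (toℕ (position x)))
  latest B B≢∅ with maximiser (allFin n) ∈-allFin ≤-totalOrder (_∈? B) (toℕ ∘ position) B≢∅
  ... | x , x∈B , x-latest = x , x∈B , λ v∈B → Equivalence.from ∈-prefix⇔ (s≤s (x-latest v∈B))

module _ (G : Graph n) {w : Fin n → Fin n} (order : GreedyOrder G w) where
  open Prefix (proj₁ order)

  peeled-min-degree : ∀ x {u} → let P = prefix w (suc (toℕ (position x))) in
                      u ∈ₛ P → degIn G P x ≤ degIn G P u
  peeled-min-degree x {u} u∈P =
    subst (λ y → degIn G P y ≤ degIn G P u) (w∘position x)
          (proj₂ order (position x) u (Equivalence.from T-≡ (∈⇒∈ᵇ u∈P)))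
    where
    P : Subset n
    P = prefix w (suc (toℕ (position x)))

  prefix-dens*½ : {W B : Subset n} → LocallyDense G W → LocallyDense G B → W ⊆ B → ∣ W ∣ < ∣ B ∣ →
                  (∀ T → LocallyDense G T → T ⊆ W ⊎ B ⊆ T) → {a : ℕ} → a < ∣ B ∣ →
                  ∃ λ i′ → a < i′ × i′ ≤ n × dens G B W *ℚ ½ ≤ℚ dens G (prefix w i′) (prefix w a)
  prefix-dens*½ {W} {B} W-dense B-dense W⊆B ∣W∣<∣B∣ dichotomy {a} a<∣B∣
    with latest B (0<∣∣⇒Nonempty (≤-trans (s≤s z≤n) a<∣B∣))
  ... | x , x∈B , B⊆P =
    i′ , a<i′ , toℕ<n (position x) , dens*½≤dens B⊆P x∈B (peeled-min-degree x) P─R≢∅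
    where
    open ConsecutiveLocallyDense G W-dense B-dense W⊆B (q⊆p⇒Nonempty[p─q] W⊆B ∣W∣<∣B∣) dichotomy
    i′ : ℕ
    i′ = suc (toℕ (position x))
    ∣P∣≡i′ : ∣ prefix w i′ ∣ ≡ i′
    ∣P∣≡i′ = ∣prefix∣ (toℕ<n (position x))
    a<i′ : a < i′
    a<i′ = <-≤-trans a<∣B∣ (subst (∣ B ∣ ≤_) ∣P∣≡i′ (p⊆q⇒∣p∣≤∣q∣ B⊆P))
    P─R≢∅ : Nonempty (prefix w i′ ─ prefix w a)
    P─R≢∅ = q⊆p⇒Nonempty[p─q] (prefix-⊆ (<⇒≤ a<i′))
      (subst₂ _<_ (sym (∣prefix∣ (≤-trans (<⇒≤ a<i′) (toℕ<n (position x))))) (sym ∣P∣≡i′) a<i′)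

-- Profiles

module _ (G : Graph n) {A A′ : Subset n} {As : List (Subset n)} {i : ℕ} where

  profileFrom-here : i ≤ ∣ A′ ∣ → profileFrom G A (A′ ∷ As) i ≡ dens G A′ A
  profileFrom-here i≤∣A′∣ with i ≤ᵇ ∣ A′ ∣ | ≤⇒≤ᵇ i≤∣A′∣
  ... | true | _ = refl

  profileFrom-later : ¬ i ≤ ∣ A′ ∣ → profileFrom G A (A′ ∷ As) i ≡ profileFrom G A′ As i
  profileFrom-later i≰∣A′∣ with i ≤ᵇ ∣ A′ ∣ | ≤ᵇ⇒≤ i ∣ A′ ∣
  ... | false | _  = refl
  ... | true  | i≤ = ⊥-elim (i≰∣A′∣ (i≤ _))

StrictChain⇒⊆ : {A T : Subset n} {As : List (Subset n)} → StrictChain A As → T ∈ As → A ⊆ T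
StrictChain⇒⊆ (A⊂A′ , _)     (here refl)  = proj₁ A⊂A′
StrictChain⇒⊆ (A⊂A′ , chain) (there T∈As) = ⊆-trans (proj₁ A⊂A′) (StrictChain⇒⊆ chain T∈As)

record Straddle (G : Graph n) (A : Subset n) (As : List (Subset n)) (i : ℕ) : Set where
  field
    lower upper : Subset n
    profile≡    : profileFrom G A As i ≡ dens G upper lower
    ∣lower∣<i   : ∣ lower ∣ < i
    i≤∣upper∣   : i ≤ ∣ upper ∣
    lower⊆upper : lower ⊆ upper
    lower∈      : lower ≡ A ⊎ lower ∈ As
    upper∈      : upper ∈ As
    dichotomy   : ∀ {T} → T ≡ A ⊎ T ∈ As → T ⊆ lower ⊎ upper ⊆ T

straddle : (G : Graph n) {A : Subset n} {As : List (Subset n)} {i : ℕ} →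
           StrictChain A As → ∣ A ∣ < i → i ≤ n → Straddle G A As i
straddle {n} G {As = []} refl ∣⊤∣<i i≤n = ⊥-elim (<⇒≱ (subst (_< _) (∣⊤∣≡n n) ∣⊤∣<i) i≤n)
straddle G {A} {A′ ∷ As} {i} (A⊂A′ , chain) ∣A∣<i i≤n with i ≤? ∣ A′ ∣
... | yes i≤∣A′∣ = record
  { lower = A ; upper = A′ ; profile≡ = profileFrom-here G {A} {A′} {As} i≤∣A′∣
  ; ∣lower∣<i = ∣A∣<i ; i≤∣upper∣ = i≤∣A′∣ ; lower⊆upper = proj₁ A⊂A′
  ; lower∈ = inj₁ refl ; upper∈ = here refl ; dichotomy = dichotomy }
  where
  dichotomy : ∀ {T} → T ≡ A ⊎ T ∈ A′ ∷ As → T ⊆ A ⊎ A′ ⊆ T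
  dichotomy (inj₁ refl)         = inj₁ ⊆-refl
  dichotomy (inj₂ (here refl))  = inj₂ ⊆-refl
  dichotomy (inj₂ (there T∈As)) = inj₂ (StrictChain⇒⊆ chain T∈As)
... | no i≰∣A′∣ = record
  { Straddle later
  ; profile≡ = trans (profileFrom-later G {A} {A′} {As} i≰∣A′∣) (Straddle.profile≡ later)
  ; lower∈ = inj₂ ([ here , there ]′ (Straddle.lower∈ later))
  ; upper∈ = there (Straddle.upper∈ later)
  ; dichotomy = dichotomy }
  where
  later : Straddle G A′ As i
  later = straddle G chain (≰⇒> i≰∣A′∣) i≤n
  open Straddle later using (lower; upper)
  A⊆lower : A ⊆ lower
  A⊆lower with Straddle.lower∈ later
  ... | inj₁ lower≡A′ = subst (A ⊆_) (sym lower≡A′) (proj₁ A⊂A′)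
  ... | inj₂ lower∈As = ⊆-trans (proj₁ A⊂A′) (StrictChain⇒⊆ chain lower∈As)
  dichotomy : ∀ {T} → T ≡ A ⊎ T ∈ A′ ∷ As → T ⊆ lower ⊎ upper ⊆ T
  dichotomy (inj₁ refl)         = inj₁ A⊆lower
  dichotomy (inj₂ (here refl))  = Straddle.dichotomy later (inj₁ refl)
  dichotomy (inj₂ (there T∈As)) = Straddle.dichotomy later (inj₂ T∈As)

record GreedyStraddle (G : Graph n) (w : Fin n → Fin n) (a₀ : ℕ) (js : List ℕ) (i : ℕ) : Set where
  field
    a j      : ℕ
    profile≡ : profileFrom G (prefix w a₀) (map (prefix w) js) i ≡ dens G (prefix w j) (prefix w a)
    a<i      : a < i
    maximal  : ∀ k → a < k → k ≤ n → dens G (prefix w k) (prefix w a) ≤ℚ dens G (prefix w j) (prefix w a)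

greedyStraddle : (G : Graph n) {w : Fin n → Fin n} → Bijective _≡_ _≡_ w → {a₀ : ℕ} {js : List ℕ} {i : ℕ} →
                 GreedyIndices G w a₀ js → a₀ < i → i ≤ n → GreedyStraddle G w a₀ js i
greedyStraddle G w-bij {js = []} a₀≡n a₀<i i≤n = ⊥-elim (<⇒≱ (subst (_< _) a₀≡n a₀<i) i≤n)
greedyStraddle G {w} w-bij {a₀} {j ∷ js} {i} (_ , _ , j≤n , j-maximal , greedy) a₀<i i≤n with i ≤? j
... | yes i≤j = record
  { a = a₀ ; j = j ; a<i = a₀<i ; maximal = j-maximal
  ; profile≡ = profileFrom-here G {prefix w a₀} {prefix w j} {map (prefix w) js} (subst (i ≤_) (sym ∣P∣≡j) i≤j) }
  where
  ∣P∣≡j : ∣ prefix w j ∣ ≡ j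
  ∣P∣≡j = Prefix.∣prefix∣ w-bij j≤n
... | no i≰j = record
  { GreedyStraddle later
  ; profile≡ = trans (profileFrom-later G {prefix w a₀} {prefix w j} {map (prefix w) js} (i≰j ∘ subst (i ≤_) ∣P∣≡j))
                     (GreedyStraddle.profile≡ later) }
  where
  ∣P∣≡j : ∣ prefix w j ∣ ≡ j
  ∣P∣≡j = Prefix.∣prefix∣ w-bij j≤n
  later : GreedyStraddle G w j js i
  later = greedyStraddle G w-bij greedy (≰⇒> i≰j) i≤n

proposition7 : (n : ℕ) → 1 ≤ n → (G : Graph n) →
  (Bs : List (Subset n)) → StrictChain ⊥ Bs →
  (∀ W → LocallyDense G W ⇔ (W ≡ ⊥ ⊎ W ∈ Bs)) →
  (w : Fin n → Fin n) → GreedyOrder G w →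
  (js : List ℕ) → GreedyIndices G w 0 js →
  ∀ i → 1 ≤ i → i ≤ n →
  profile G Bs i *ℚ ½ ≤ℚ profile G (greedyChain w js) i
proposition7 n _ G Bs chain dense⇔ w order js greedy i 1≤i i≤n =
  let (i′ , a<i′ , i′≤n , B*½≤P) = prefix-dens*½ G order (dense lower∈) (dense (inj₂ upper∈)) lower⊆upper
                                     (<-≤-trans ∣lower∣<i i≤∣upper∣) between (<-≤-trans a<i i≤∣upper∣)
  in begin
    profile G Bs i *ℚ ½                ≡⟨ cong (_*ℚ ½) profile≡ ⟩
    dens G upper lower *ℚ ½            ≤⟨ B*½≤P ⟩
    dens G (prefix w i′) (prefix w a)  ≤⟨ maximal i′ a<i′ i′≤n ⟩
    dens G (prefix w j) (prefix w a)   ≡⟨ greedy-profile≡ ⟨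
    profile G (greedyChain w js) i     ∎
  where
  open ℚ.≤-Reasoning
  open Straddle (straddle G chain (subst (_< i) (sym (∣⊥∣≡0 n)) 1≤i) i≤n)
  open GreedyStraddle (greedyStraddle G (proj₁ order) greedy 1≤i i≤n) renaming (profile≡ to greedy-profile≡′)
  dense : ∀ {T} → T ≡ ⊥ ⊎ T ∈ Bs → LocallyDense G T
  dense = Equivalence.from (dense⇔ _)
  between : ∀ T → LocallyDense G T → T ⊆ lower ⊎ upper ⊆ T
  between T = dichotomy ∘ Equivalence.to (dense⇔ T)
  greedy-profile≡ : profile G (greedyChain w js) i ≡ dens G (prefix w j) (prefix w a)
  greedy-profile≡ = subst (λ S → profileFrom G S (greedyChain w js) i ≡ dens G (prefix w j) (prefix w a))
                          (Prefix.prefix-0 (proj₁ order)) greedy-profile≡′
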